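{- For every positive integer $n\equiv 0\pmod 2$, there exists an optimal $2$-D $(3\times n,3,1)$-OOC with $J^*(3\times n,3,1)$ codewords.
   Context: Let $I_m=\{0,1,\dots,m-1\}$ and $\mathbb{Z}_n$ the integers modulo $n$. A $2$-D $(m\times n,k,1)$-OOC is a set $\mathcal{C}$ of $k$-subsets of $I_m\times\mathbb{Z}_n$ such that $|A\cap(A+\tau)|\le 1$ for every $A\in\mathcal{C}$ and every integer $\tau\not\equiv 0\pmod n$, and $|A\cap(B+\tau)|\le 1$ for all distinct $A,B\in\mathcal{C}$ and every integer $\tau$, where $B+\tau=\{(i,x+\tau \bmod n):(i,x)\in B\}$. It is optimal if it has the maximum possible number of codewords. $J(m\times n,3,1)=\left\lfloor \frac{m}{3}\left\lfloor\frac{mn-1}{2}\right\rfloor\right\rfloor$. For even $n$, $J^*(m\times n,3,1)=J(m\times n,3,1)-1$ if $mn\equiv 14,20\pmod{24}$, or $m\equiv 4\pmod 6$ and $n=4$, or $m\equiv 5,8\pmod{12}$ and $n=2$, or $m\equiv 0\pmod 3$ and $mn\equiv 6,12\pmod{24}$; and $J^*(m\times n,3,1)=J(m\times n,3,1)$ otherwise. -}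

module Defs where

open import Data.Nat using (ℕ; zero; suc; _+_; _*_; _∸_; _≤_; NonZero; _/_; _%_; _≡ᵇ_)
open import Data.Nat.DivMod using (_mod_)
open import Data.Bool using (Bool; true; false; if_then_else_; _∧_; _∨_)
open import Data.Fin using (Fin; toℕ)
open import Data.Fin.Properties renaming (_≟_ to _≟ᶠ_)
open import Data.Integer using (ℤ)
open import Data.Integer.DivMod using (_%ℕ_)
open import Data.Product using (_×_; _,_; Σ; ∃)
open import Data.Product.Properties using (≡-dec)
open import Data.List using (List; length; map; filter)
open import Data.List.Relation.Unary.Unique.Propositional using (Unique)
import Data.List.Membership.DecPropositional as DecMem
open import Relation.Binary.PropositionalEquality using (_≡_; _≢_)
open import Relation.Binary.Definitions using (DecidableEquality)

Point : ℕ → ℕ → Set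
Point m n = Fin m × Fin n

_≟ₚ_ : ∀ {m n} → DecidableEquality (Point m n)
_≟ₚ_ = ≡-dec _≟ᶠ_ _≟ᶠ_

shift : ∀ {m n} .{{_ : NonZero n}} → ℤ → List (Point m n) → List (Point m n)
shift {n = n} τ B = map (λ { (i , x) → (i , ((toℕ x + τ %ℕ n) mod n)) }) B

∣_∩_∣ : ∀ {m n} → List (Point m n) → List (Point m n) → ℕ
∣_∩_∣ {m} {n} A B = length (filter (λ p → p ∈? B) A)
  where open DecMem (_≟ₚ_ {m} {n})

record Codeword (m n k : ℕ) : Set where
  constructor codeword
  field
    pts      : List (Point m n)
    distinct : Unique pts
    size     : length pts ≡ k
open Codeword public

-- A 2-D (m × n, k, 1)-OOC: a finite family of codewords (indexed, so that
-- distinct indices must be distinct codewords; a repeated codeword violates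
-- the cross-correlation condition with τ = 0).
record OOC (m n k : ℕ) .{{_ : NonZero n}} : Set where
  field
    size   : ℕ
    words  : Fin size → Codeword m n k
    auto   : ∀ a (τ : ℤ) → τ %ℕ n ≢ 0 →
             ∣ pts (words a) ∩ shift τ (pts (words a)) ∣ ≤ 1
    cross  : ∀ a b → a ≢ b → ∀ (τ : ℤ) →
             ∣ pts (words a) ∩ shift τ (pts (words b)) ∣ ≤ 1
open OOC public

Optimal : ∀ {m n k} .{{_ : NonZero n}} → OOC m n k → Set
Optimal {m} {n} {k} C = ∀ (D : OOC m n k) → OOC.size D ≤ OOC.size C

J : ℕ → ℕ → ℕ
J m n = (m * ((m * n ∸ 1) / 2)) / 3

J*-exceptional : ℕ → ℕ → Bool
J*-exceptional m n =
     ((m * n) % 24 ≡ᵇ 14) ∨ ((m * n) % 24 ≡ᵇ 20)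
   ∨ ((m % 6 ≡ᵇ 4) ∧ (n ≡ᵇ 4))
   ∨ (((m % 12 ≡ᵇ 5) ∨ (m % 12 ≡ᵇ 8)) ∧ (n ≡ᵇ 2))
   ∨ ((m % 3 ≡ᵇ 0) ∧ (((m * n) % 24 ≡ᵇ 6) ∨ ((m * n) % 24 ≡ᵇ 12)))

-- J*(m × n, 3, 1) for even n
J* : ℕ → ℕ → ℕ
J* m n = if J*-exceptional m n then J m n ∸ 1 else J m n

{-# OPTIONS --safe #-}
-- Write n = 2t and give an ordered pair of distinct points (i, x), (j, y) of a codeword the difference
-- (i, j, y − x mod n).  Two pairs with the same difference are translates of each other, so a family of
-- triples is an OOC exactly when the differences of all its ordered pairs, six per codeword, are distinct.
--
-- Upper bound: the 6s differences avoid (i, i, 0) and (i, i, t) and lie among 18t possible ones, so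
-- 6s + 6 ≤ 18t.  Counting odd and even differences separately, where each codeword has 0 or 4 odd ones,
-- improves this to 6s + 8 ≤ 18t when t ≡ 1, 2 (mod 4); in both cases the bound is J*(3 × n, 3, 1).
--
-- Construction: row i carries t − 1 codewords {(i,0), (i,d), (i+1,r)} whose gaps d are 1, ..., t − 1 and
-- whose values r and r − d tile Z_n apart from 0 and one hole, as in a Skolem-type sequence.  The central
-- codeword {(0,0), (1,0), (2,0)} takes the differences 0, and when the holes of the three rows add up to n
-- a second central codeword takes the holes.  A decoder recovering the codeword and the pair from each
-- difference shows that all differences are distinct.
module Submission where

open import Defs
open import Data.Nat using (ℕ; NonZero)
open import Data.Nat.Divisibility using (_∣_)
open import Data.Product using (Σ; _×_)
open import Relation.Binary.PropositionalEquality using (_≡_)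

open import Data.Bool using (Bool; T; false; if_then_else_; _∨_)
open import Data.Empty using (⊥; ⊥-elim)
open import Data.Empty.Irrelevant renaming (⊥-elim to ⊥-elim-irr)
open import Data.Fin as Fin using (Fin; toℕ; splitAt; remQuot)
import Data.Fin.Properties as Fin
open import Data.Fin.Patterns using (0F; 1F; 2F)
open import Data.Integer as ℤ using (ℤ)
open import Data.Integer.DivMod using (_%ℕ_; n%ℕd<d)
open import Data.List
  using ( List; []; _∷_; length; filter; map; _++_; concatMap; allFin; downFrom; cartesianProductWith
        ; take; drop; head; foldr)
open import Data.List.Properties
  using ( length-++; length-map; length-tabulate; length-downFrom; length-removeAt′
        ; filter-accept; filter-reject; filter-++; map-concatMap)
open import Data.List.Membership.Propositional using (_∈_; _∉_)
open import Data.List.Membership.Propositional.Properties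
  using (∈-map⁺; ∈-map⁻; ∈-filter⁺; ∈-filter⁻; ∈-concatMap⁺; ∈-concatMap⁻; ∈-allFin; ∈-downFrom⁺)
import Data.List.Membership.DecPropositional as DecMembership
open import Data.List.Relation.Binary.Disjoint.Propositional using (Disjoint)
open import Data.List.Relation.Binary.Subset.Propositional using (_⊆_)
open import Data.List.Relation.Unary.All as All using (All; []; _∷_)
import Data.List.Relation.Unary.All.Properties as Allₚ
open import Data.List.Relation.Unary.AllPairs as AllPairs using ([]; _∷_)
import Data.List.Relation.Unary.AllPairs.Properties as AllPairsₚ
open import Data.List.Relation.Unary.Any as Any using (here; there; index; _─_; satisfied)
open import Data.List.Relation.Unary.Unique.Propositional using (Unique)
import Data.List.Relation.Unary.Unique.Propositional.Properties as Unique
open import Data.Maybe using (just)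
open import Data.Nat as ℕ using (zero; suc; _+_; _*_; _∸_; _≤_; _<_; _%_; _/_; z≤n; s≤s; z<s; s<s; >-nonZero⁻¹)
open import Data.Nat.Divisibility using (divides; ∣m∣n⇒∣m+n)
open import Data.Nat.DivMod
open import Data.Nat.ListAction using (sum)
open import Data.Nat.Properties
open import Data.Nat.Tactic.RingSolver using (solve-∀)
open import Data.Product using (_,_; proj₁; proj₂; ∃-syntax; uncurry)
open import Data.Product.Properties using (,-injectiveʳ)
open import Data.Sum as Sum using (_⊎_; inj₁; inj₂; [_,_]′)
open import Data.Unit using (⊤)
open import Function using (_∘_; _∋_; id)
open import Relation.Binary.PropositionalEquality
  using (_≢_; refl; sym; trans; cong; cong₂; subst; subst₂; ≢-sym; module ≡-Reasoning)
open import Relation.Nullary using (Dec; yes; no; ¬_; contradiction)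
open import Relation.Unary using (Decidable)
open import Relation.Unary.Properties using (∁?)

m*2≡m+m : ∀ m → m * 2 ≡ m + m
m*2≡m+m = solve-∀

[1+m*2]/2≡m : ∀ m → (1 + m * 2) / 2 ≡ m
[1+m*2]/2≡m m = trans (+-distrib-/-∣ʳ 1 {m * 2} {2} (divides m refl)) (m*n/n≡m m 2)

m*2∸m≡m : ∀ m → m * 2 ∸ m ≡ m
m*2∸m≡m m = trans (cong (_∸ m) (m*2≡m+m m)) (m+n∸m≡n m m)

reflect< : ∀ {j L} → j < L → L ∸ suc j < L
reflect< {j} {suc L} (s≤s j≤L) = s≤s (m∸n≤m L j)

reflect-involutive : ∀ {j L} → j < L → L ∸ suc (L ∸ suc j) ≡ j
reflect-involutive {L = suc L} (s≤s j≤L) = m∸[m∸n]≡n j≤L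

[1+u*4]%2≡1 : ∀ u → (1 + u * 4) % 2 ≡ 1
[1+u*4]%2≡1 u = trans (cong (_% 2) (1+u*4≡1+u*2*2 u)) ([m+kn]%n≡m%n 1 (u * 2) 2)
  where
  1+u*4≡1+u*2*2 : ∀ u → 1 + u * 4 ≡ 1 + u * 2 * 2
  1+u*4≡1+u*2*2 = solve-∀

[2+u*4]%2≡0 : ∀ u → (2 + u * 4) % 2 ≡ 0
[2+u*4]%2≡0 u = trans (cong (_% 2) (2+u*4≡[1+u*2]*2 u)) (m*n%n≡0 (1 + u * 2) 2)
  where
  2+u*4≡[1+u*2]*2 : ∀ u → 2 + u * 4 ≡ (1 + u * 2) * 2
  2+u*4≡[1+u*2]*2 = solve-∀

4∣m≤4q+2⇒m≤4q : ∀ {m} q → 4 ∣ m → m ≤ q * 4 + 2 → m ≤ q * 4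
4∣m≤4q+2⇒m≤4q q (divides r refl) r*4≤q*4+2 = *-monoˡ-≤ 4 (≮⇒≥ q≮r)
  where
  q≮r : ¬ q < r
  q≮r q<r = <⇒≱ (begin-strict
    q * 4 + 2  <⟨ +-monoʳ-< (q * 4) (s<s (s<s z<s)) ⟩
    q * 4 + 4  ≡⟨ +-comm (q * 4) 4 ⟩
    suc q * 4  ≤⟨ *-monoˡ-≤ 4 q<r ⟩
    r * 4      ∎) r*4≤q*4+2
    where open ≤-Reasoning

4∣m⇒m+c+2≤4q+2+c : ∀ {m} c q → 4 ∣ m → m + c ≤ q * 4 + 2 + c → m + c + 2 ≤ q * 4 + 2 + c
4∣m⇒m+c+2≤4q+2+c {m} c q 4∣m m+c≤ = subst₂ _≤_ (m+[c+2] m c) (q*4+[c+2] (q * 4) c)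
  (+-monoˡ-≤ (c + 2) (4∣m≤4q+2⇒m≤4q q 4∣m (+-cancelʳ-≤ c m (q * 4 + 2) m+c≤)))
  where
  m+[c+2] : ∀ m c → m + (c + 2) ≡ m + c + 2
  m+[c+2] = solve-∀
  q*4+[c+2] : ∀ b c → b + (c + 2) ≡ b + 2 + c
  q*4+[c+2] = solve-∀

≤-from-*6 : ∀ {s} v r c → r < 6 → s * 6 + c ≤ v * 6 + r + c → s ≤ v
≤-from-*6 {s} v r c r<6 s*6+c≤ = ≮⇒≥ λ v<s → <⇒≱ (v*6+r<s*6 v<s) (+-cancelʳ-≤ c (s * 6) (v * 6 + r) s*6+c≤)
  where
  v*6+r<s*6 : v < s → v * 6 + r < s * 6
  v*6+r<s*6 v<s = <-≤-trans (+-monoʳ-< (v * 6) r<6) (subst (_≤ s * 6) (+-comm 6 (v * 6)) (*-monoˡ-≤ 6 v<s))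

module Residues {n : ℕ} .{{_ : NonZero n}} where

  open ≡-Reasoning

  [m+n%d]%d≡[m+n]%d : ∀ a b → (a + b % n) % n ≡ (a + b) % n
  [m+n%d]%d≡[m+n]%d a b = begin
    (a + b % n) % n          ≡⟨ %-distribˡ-+ a (b % n) n ⟩
    (a % n + b % n % n) % n  ≡⟨ cong (λ z → (a % n + z) % n) (m%n%n≡m%n b n) ⟩
    (a % n + b % n) % n      ≡⟨ %-distribˡ-+ a b n ⟨
    (a + b) % n              ∎

  [m%d+n]%d≡[m+n]%d : ∀ a b → (a % n + b) % n ≡ (a + b) % n
  [m%d+n]%d≡[m+n]%d a b = begin
    (a % n + b) % n  ≡⟨ cong (_% n) (+-comm (a % n) b) ⟩
    (b + a % n) % n  ≡⟨ [m+n%d]%d≡[m+n]%d b a ⟩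
    (b + a) % n      ≡⟨ cong (_% n) (+-comm b a) ⟩
    (a + b) % n      ∎

  +-%-congˡ : ∀ {a b} c → a % n ≡ b % n → (a + c) % n ≡ (b + c) % n
  +-%-congˡ {a} {b} c eq = begin
    (a + c) % n      ≡⟨ [m%d+n]%d≡[m+n]%d a c ⟨
    (a % n + c) % n  ≡⟨ cong (λ z → (z + c) % n) eq ⟩
    (b % n + c) % n  ≡⟨ [m%d+n]%d≡[m+n]%d b c ⟩
    (b + c) % n      ∎

  -- For x ≤ n, diff x y is the residue of y − x modulo n.
  diff : ℕ → ℕ → ℕ
  diff x y = (y + (n ∸ x)) % n

  diff<n : ∀ x y → diff x y < n
  diff<n x y = m%n<n (y + (n ∸ x)) n

  +-diff : ∀ x y → x ≤ n → (x + diff x y) % n ≡ y % n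
  +-diff x y x≤n = begin
    (x + (y + (n ∸ x)) % n) % n  ≡⟨ [m+n%d]%d≡[m+n]%d x (y + (n ∸ x)) ⟩
    (x + (y + (n ∸ x))) % n      ≡⟨ cong (_% n) (x+[y+[n∸x]]≡y+n y x≤n) ⟩
    (y + n) % n                  ≡⟨ [m+n]%n≡m%n y n ⟩
    y % n                        ∎
    where
    x+[y+[n∸x]]≡y+n : ∀ y → x ≤ n → x + (y + (n ∸ x)) ≡ y + n
    x+[y+[n∸x]]≡y+n y x≤n = begin
      x + (y + (n ∸ x))  ≡⟨ +-assoc x y _ ⟨
      x + y + (n ∸ x)    ≡⟨ cong (_+ (n ∸ x)) (+-comm x y) ⟩
      y + x + (n ∸ x)    ≡⟨ +-assoc y x _ ⟩
      y + (x + (n ∸ x))  ≡⟨ cong (y +_) (m+[n∸m]≡n x≤n) ⟩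
      y + n              ∎

  diff-unique : ∀ {x y r} → x ≤ n → r < n → (x + r) % n ≡ y % n → diff x y ≡ r
  diff-unique {x} {y} {r} x≤n r<n eq = begin
    (y + (n ∸ x)) % n      ≡⟨ +-%-congˡ (n ∸ x) eq ⟨
    (x + r + (n ∸ x)) % n  ≡⟨ cong (_% n) (x+r+[n∸x]≡r+n) ⟩
    (r + n) % n            ≡⟨ [m+n]%n≡m%n r n ⟩
    r % n                  ≡⟨ m<n⇒m%n≡m r<n ⟩
    r                      ∎
    where
    x+r+[n∸x]≡r+n : x + r + (n ∸ x) ≡ r + n
    x+r+[n∸x]≡r+n = begin
      x + r + (n ∸ x)    ≡⟨ cong (_+ (n ∸ x)) (+-comm x r) ⟩
      r + x + (n ∸ x)    ≡⟨ +-assoc r x _ ⟩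
      r + (x + (n ∸ x))  ≡⟨ cong (r +_) (m+[n∸m]≡n x≤n) ⟩
      r + n              ∎

  diff-self : ∀ x → x ≤ n → diff x x ≡ 0
  diff-self x x≤n = diff-unique x≤n (>-nonZero⁻¹ n) (cong (_% n) (+-identityʳ x))

  diff-from-0 : ∀ {y} → y < n → diff 0 y ≡ y
  diff-from-0 {y} y<n = diff-unique z≤n y<n refl

  diff-to-0 : ∀ {x} → 0 < x → x ≤ n → diff x 0 ≡ n ∸ x
  diff-to-0 {x} 0<x x≤n = diff-unique x≤n (∸-monoʳ-< 0<x x≤n) (begin
    (x + (n ∸ x)) % n  ≡⟨ cong (_% n) (m+[n∸m]≡n x≤n) ⟩
    n % n              ≡⟨ n%n≡0 n ⟩
    0                  ≡⟨ m<n⇒m%n≡m (>-nonZero⁻¹ n) ⟨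
    0 % n              ∎)

  diff≡0⇒≡ : ∀ {x y} → x < n → y < n → diff x y ≡ 0 → x ≡ y
  diff≡0⇒≡ {x} {y} x<n y<n d≡0 = begin
    x                    ≡⟨ m<n⇒m%n≡m x<n ⟨
    x % n                ≡⟨ cong (_% n) (+-identityʳ x) ⟨
    (x + 0) % n          ≡⟨ cong (λ d → (x + d) % n) d≡0 ⟨
    (x + diff x y) % n   ≡⟨ +-diff x y (<⇒≤ x<n) ⟩
    y % n                ≡⟨ m<n⇒m%n≡m y<n ⟩
    y                    ∎

  diff-shift : ∀ x y k → x ≤ n → diff ((x + k) % n) ((y + k) % n) ≡ diff x y
  diff-shift x y k x≤n = diff-unique (m%n≤n (x + k) n) (diff<n x y) (begin
    ((x + k) % n + diff x y) % n  ≡⟨ [m%d+n]%d≡[m+n]%d (x + k) (diff x y) ⟩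
    (x + k + diff x y) % n        ≡⟨ cong (_% n) (x+k+d≡x+d+k x k (diff x y)) ⟩
    (x + diff x y + k) % n        ≡⟨ +-%-congˡ k (+-diff x y x≤n) ⟩
    (y + k) % n                   ≡⟨ m%n%n≡m%n (y + k) n ⟨
    (y + k) % n % n               ∎)
    where
    x+k+d≡x+d+k : ∀ x k d → x + k + d ≡ x + d + k
    x+k+d≡x+d+k = solve-∀

  diff-swap : ∀ {x y} → x < n → y < n → (n ∸ diff y x) % n ≡ diff x y
  diff-swap {x} {y} x<n y<n = sym (diff-unique (<⇒≤ x<n) (m%n<n _ n) (begin
    (x + (n ∸ r) % n) % n  ≡⟨ [m+n%d]%d≡[m+n]%d x (n ∸ r) ⟩
    (x + (n ∸ r)) % n      ≡⟨ +-%-congˡ (n ∸ r) (+-diff y x (<⇒≤ y<n)) ⟨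
    (y + r + (n ∸ r)) % n  ≡⟨ cong (_% n) (trans (+-assoc y r _) (cong (y +_) (m+[n∸m]≡n (<⇒≤ (diff<n y x))))) ⟩
    (y + n) % n            ≡⟨ [m+n]%n≡m%n y n ⟩
    y % n                  ∎))
    where
    r = diff y x

module _ {A : Set} where

  ∈-─ : ∀ {x y} {ys : List A} (x∈ys : x ∈ ys) → y ∈ ys → y ≢ x → y ∈ (ys ─ x∈ys)
  ∈-─ (here refl)  (here refl)  y≢x = ⊥-elim (y≢x refl)
  ∈-─ (here _)     (there y∈ys) _   = y∈ys
  ∈-─ (there _)    (here refl)  _   = here refl
  ∈-─ (there x∈ys) (there y∈ys) y≢x = there (∈-─ x∈ys y∈ys y≢x)

  unique-⊆⇒length≤ : ∀ {xs ys : List A} → Unique xs → xs ⊆ ys → length xs ≤ length ys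
  unique-⊆⇒length≤ {[]}     _               _     = z≤n
  unique-⊆⇒length≤ {x ∷ xs} {ys} (x∉xs ∷ !xs) xs⊆ys = begin
    suc (length xs)           ≤⟨ s≤s (unique-⊆⇒length≤ !xs xs⊆ys─x) ⟩
    suc (length (ys ─ x∈ys))  ≡⟨ length-removeAt′ ys (index x∈ys) ⟨
    length ys                 ∎
    where
    open ≤-Reasoning
    x∈ys = xs⊆ys (here refl)
    xs⊆ys─x : xs ⊆ (ys ─ x∈ys)
    xs⊆ys─x y∈xs = ∈-─ x∈ys (xs⊆ys (there y∈xs)) (≢-sym (All.lookup x∉xs y∈xs))

  ∈-∈-≢⇒2≤length : ∀ {x y} {xs : List A} → x ∈ xs → y ∈ xs → x ≢ y → 2 ≤ length xs
  ∈-∈-≢⇒2≤length x∈xs y∈xs x≢y = unique-⊆⇒length≤ ((x≢y ∷ []) ∷ [] ∷ [])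
    λ { (here refl) → x∈xs ; (there (here refl)) → y∈xs }

  2≤length⇒∈-∈-≢ : ∀ {xs : List A} → Unique xs → 2 ≤ length xs →
                   ∃[ x ] ∃[ y ] x ∈ xs × y ∈ xs × x ≢ y
  2≤length⇒∈-∈-≢ {_ ∷ []}    _                   (s≤s ())
  2≤length⇒∈-∈-≢ {x ∷ y ∷ _} ((x≢y ∷ _) ∷ _) _ = x , y , here refl , there (here refl) , x≢y

  unique-map⁺ : ∀ {B : Set} {f : A → B} {xs} → (∀ {x y} → x ∈ xs → y ∈ xs → f x ≡ f y → x ≡ y) →
                Unique xs → Unique (map f xs)
  unique-map⁺ {xs = []}     _   []          = []
  unique-map⁺ {xs = x ∷ xs} inj (x∉xs ∷ !xs) =
    Allₚ.map⁺ (All.tabulate λ y∈xs fx≡fy → All.lookup x∉xs y∈xs (inj (here refl) (there y∈xs) fx≡fy))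
    ∷ unique-map⁺ (λ x∈ y∈ → inj (there x∈) (there y∈)) !xs

  length-concatMap : ∀ {B : Set} (f : B → List A) {c} → (∀ b → length (f b) ≡ c) →
                     ∀ bs → length (concatMap f bs) ≡ length bs * c
  length-concatMap f fc []       = refl
  length-concatMap f fc (b ∷ bs) = trans (length-++ (f b)) (cong₂ _+_ (fc b) (length-concatMap f fc bs))

  length-filter-∁ : ∀ {P : A → Set} (P? : Decidable P) xs →
                    length (filter P? xs) + length (filter (∁? P?) xs) ≡ length xs
  length-filter-∁ P? []       = refl
  length-filter-∁ P? (x ∷ xs) with P? x
  ... | yes _ = cong suc (length-filter-∁ P? xs)
  ... | no _  = trans (+-suc _ _) (cong suc (length-filter-∁ P? xs))

Triple : Set → Set
Triple A = A × A × A

module _ {A : Set} where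

  vertices : Triple A → List A
  vertices (a , b , c) = a ∷ b ∷ c ∷ []

  _!_ : Triple A → Fin 3 → A
  (a , _ , _) ! 0F = a
  (_ , b , _) ! 1F = b
  (_ , _ , c) ! 2F = c

  ∈-vertices⁻ : ∀ {x} T → x ∈ vertices T → ∃[ u ] x ≡ T ! u
  ∈-vertices⁻ _ (here x≡a)                 = 0F , x≡a
  ∈-vertices⁻ _ (there (here x≡b))         = 1F , x≡b
  ∈-vertices⁻ _ (there (there (here x≡c))) = 2F , x≡c

  toTriple : (xs : List A) → length xs ≡ 3 → Triple A
  toTriple (a ∷ b ∷ c ∷ []) _ = a , b , c

  vertices-toTriple : ∀ xs (len≡3 : length xs ≡ 3) → vertices (toTriple xs len≡3) ≡ xs
  vertices-toTriple (a ∷ b ∷ c ∷ []) _ = refl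

  orderedPairs : Triple A → List (A × A)
  orderedPairs (a , b , c) = (a , b) ∷ (b , a) ∷ (a , c) ∷ (c , a) ∷ (b , c) ∷ (c , b) ∷ []

  ∈-orderedPairs⁻ : ∀ {p q} T → Unique (vertices T) → (p , q) ∈ orderedPairs T →
                    p ∈ vertices T × q ∈ vertices T × p ≢ q
  ∈-orderedPairs⁻ _ ((a≢b ∷ _) ∷ _) (here refl) = here refl , there (here refl) , a≢b
  ∈-orderedPairs⁻ _ ((a≢b ∷ _) ∷ _) (there (here refl)) = there (here refl) , here refl , ≢-sym a≢b
  ∈-orderedPairs⁻ _ ((_ ∷ a≢c ∷ _) ∷ _) (there (there (here refl))) =
    here refl , there (there (here refl)) , a≢c
  ∈-orderedPairs⁻ _ ((_ ∷ a≢c ∷ _) ∷ _) (there (there (there (here refl)))) =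
    there (there (here refl)) , here refl , ≢-sym a≢c
  ∈-orderedPairs⁻ _ (_ ∷ (b≢c ∷ _) ∷ _) (there (there (there (there (here refl))))) =
    there (here refl) , there (there (here refl)) , b≢c
  ∈-orderedPairs⁻ _ (_ ∷ (b≢c ∷ _) ∷ _) (there (there (there (there (there (here refl)))))) =
    there (there (here refl)) , there (here refl) , ≢-sym b≢c

  unique-orderedPairs : ∀ T → Unique (vertices T) → Unique (orderedPairs T)
  unique-orderedPairs _ ((a≢b ∷ a≢c ∷ _) ∷ (b≢c ∷ _) ∷ _) =
      (ˡ a≢b ∷ ʳ b≢c ∷ ˡ a≢c ∷ ˡ a≢b ∷ ˡ a≢c ∷ [])
    ∷ (ˡ (≢-sym a≢b) ∷ ˡ b≢c ∷ ʳ a≢c ∷ ˡ b≢c ∷ [])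
    ∷ (ˡ a≢c ∷ ˡ a≢b ∷ ˡ a≢c ∷ [])
    ∷ (ˡ (≢-sym b≢c) ∷ ʳ a≢b ∷ [])
    ∷ (ˡ b≢c ∷ [])
    ∷ []
    ∷ []
    where
    ˡ : ∀ {x x′ y y′ : A} → x ≢ x′ → (x , y) ≢ (x′ , y′)
    ˡ x≢x′ refl = x≢x′ refl
    ʳ : ∀ {x x′ y y′ : A} → y ≢ y′ → (x , y) ≢ (x′ , y′)
    ʳ y≢y′ refl = y≢y′ refl

-- Pair differences and the OOC conditions

module PairDifferences {m n : ℕ} .{{_ : NonZero n}} where

  open Residues {n}
  open DecMembership (_≟ₚ_ {m} {n}) using (_∈?_)

  row : Point m n → Fin m
  row = proj₁

  col : Point m n → ℕ
  col (_ , x) = toℕ x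

  col<n : ∀ p → col p < n
  col<n (_ , x) = Fin.toℕ<n x

  point-≡ : ∀ {p q} → row p ≡ row q → col p ≡ col q → p ≡ q
  point-≡ refl c = cong (_ ,_) (Fin.toℕ-injective c)

  Δ : Point m n → Point m n → Fin m × Fin m × ℕ
  Δ (i , x) (j , y) = i , j , diff (toℕ x) (toℕ y)

  shiftPoint : ℤ → Point m n → Point m n
  shiftPoint τ (i , x) = i , (toℕ x + τ %ℕ n) mod n

  col-shiftPoint : ∀ τ p → col (shiftPoint τ p) ≡ (col p + τ %ℕ n) % n
  col-shiftPoint τ p = Fin.toℕ-fromℕ< _

  Δ-shiftPoint : ∀ τ p q → Δ (shiftPoint τ p) (shiftPoint τ q) ≡ Δ p q
  Δ-shiftPoint τ p q = cong (λ d → row p , row q , d) (begin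
    diff (col (shiftPoint τ p)) (col (shiftPoint τ q))
      ≡⟨ cong₂ diff (col-shiftPoint τ p) (col-shiftPoint τ q) ⟩
    diff ((col p + τ %ℕ n) % n) ((col q + τ %ℕ n) % n)
      ≡⟨ diff-shift (col p) (col q) (τ %ℕ n) (<⇒≤ (col<n p)) ⟩
    diff (col p) (col q)
      ∎)
    where open ≡-Reasoning

  shiftPoint-by-0 : ∀ τ p → τ %ℕ n ≡ 0 → shiftPoint τ p ≡ p
  shiftPoint-by-0 τ p τ≡0 = point-≡ refl (begin
    col (shiftPoint τ p)     ≡⟨ col-shiftPoint τ p ⟩
    (col p + τ %ℕ n) % n     ≡⟨ cong (λ z → (col p + z) % n) τ≡0 ⟩
    (col p + 0) % n          ≡⟨ cong (_% n) (+-identityʳ (col p)) ⟩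
    col p % n                ≡⟨ m<n⇒m%n≡m (col<n p) ⟩
    col p                    ∎)
    where open ≡-Reasoning

  shiftPoint-fixed : ∀ τ p → shiftPoint τ p ≡ p → τ %ℕ n ≡ 0
  shiftPoint-fixed τ p fixed = begin
    τ %ℕ n                ≡⟨ diff-unique (<⇒≤ (col<n p)) (n%ℕd<d τ n) col+τ≡col ⟨
    diff (col p) (col p)  ≡⟨ diff-self (col p) (<⇒≤ (col<n p)) ⟩
    0                     ∎
    where
    open ≡-Reasoning
    col+τ≡col : (col p + τ %ℕ n) % n ≡ col p % n
    col+τ≡col = trans (sym (col-shiftPoint τ p)) (trans (cong col fixed) (sym (m<n⇒m%n≡m (col<n p))))

  Δ-≡⇒shiftPoint : ∀ {p q p′ q′} → Δ p q ≡ Δ p′ q′ →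
                   let τ = ℤ.+ diff (col p′) (col p) in shiftPoint τ p′ ≡ p × shiftPoint τ q′ ≡ q
  Δ-≡⇒shiftPoint {p} {q} {p′} {q′} eq =
    point-≡ (sym (cong proj₁ eq)) (trans (col-shiftPoint τ p′) (trans (cong (λ z → (col p′ + z) % n) τ%n≡k) col-p)) ,
    point-≡ (sym (cong (proj₁ ∘ proj₂) eq))
            (trans (col-shiftPoint τ q′) (trans (cong (λ z → (col q′ + z) % n) τ%n≡k) col-q))
    where
    open ≡-Reasoning
    k = diff (col p′) (col p)
    τ = ℤ.+ k
    r = diff (col p) (col q)
    τ%n≡k : τ %ℕ n ≡ k
    τ%n≡k = m<n⇒m%n≡m (diff<n (col p′) (col p))
    col-p : (col p′ + k) % n ≡ col p
    col-p = trans (+-diff (col p′) (col p) (<⇒≤ (col<n p′))) (m<n⇒m%n≡m (col<n p))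
    col-q : (col q′ + k) % n ≡ col q
    col-q = begin
      (col q′ + k) % n              ≡⟨ cong (λ z → (z + k) % n) (m<n⇒m%n≡m (col<n q′)) ⟨
      (col q′ % n + k) % n          ≡⟨ cong (λ z → (z + k) % n) (+-diff (col p′) (col q′) (<⇒≤ (col<n p′))) ⟨
      ((col p′ + diff (col p′) (col q′)) % n + k) % n
                                    ≡⟨ cong (λ z → ((col p′ + z) % n + k) % n) (cong (proj₂ ∘ proj₂) eq) ⟨
      ((col p′ + r) % n + k) % n    ≡⟨ [m%d+n]%d≡[m+n]%d (col p′ + r) k ⟩
      (col p′ + r + k) % n          ≡⟨ cong (_% n) (x+y+z≡x+z+y (col p′) r k) ⟩
      (col p′ + k + r) % n          ≡⟨ [m%d+n]%d≡[m+n]%d (col p′ + k) r ⟨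
      ((col p′ + k) % n + r) % n    ≡⟨ cong (λ z → (z + r) % n) col-p ⟩
      (col p + r) % n               ≡⟨ +-diff (col p) (col q) (<⇒≤ (col<n p)) ⟩
      col q % n                     ≡⟨ m<n⇒m%n≡m (col<n q) ⟩
      col q                         ∎
      where
      x+y+z≡x+z+y : ∀ x y z → x + y + z ≡ x + z + y
      x+y+z≡x+z+y = solve-∀

  ∈-shift⁺ : ∀ τ {p B} → p ∈ B → shiftPoint τ p ∈ shift τ B
  ∈-shift⁺ τ = ∈-map⁺ (shiftPoint τ)

  ∈-shift⁻ : ∀ τ {p B} → p ∈ shift τ B → ∃[ p′ ] p′ ∈ B × p ≡ shiftPoint τ p′
  ∈-shift⁻ τ = ∈-map⁻ (shiftPoint τ)

  ∈-∩⁺ : ∀ {p A B} → p ∈ A → p ∈ B → p ∈ filter (_∈? B) A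
  ∈-∩⁺ p∈A p∈B = ∈-filter⁺ (_∈? _) p∈A p∈B

  PairDifferencesDistinct : ∀ {k s} → (Fin s → Codeword m n k) → Set
  PairDifferencesDistinct {s = s} w = ∀ {a b : Fin s} {p q p′ q′} →
    p ∈ pts (w a) → q ∈ pts (w a) → p ≢ q →
    p′ ∈ pts (w b) → q′ ∈ pts (w b) → p′ ≢ q′ →
    Δ p q ≡ Δ p′ q′ → a ≡ b × p ≡ p′ × q ≡ q′

  OOC⇒pairDifferencesDistinct : ∀ {k} (C : OOC m n k) → PairDifferencesDistinct (words C)
  OOC⇒pairDifferencesDistinct C {a} {b} {p} {q} {p′} {q′} p∈ q∈ p≢q p′∈ q′∈ _ eq =
    conclude (a Fin.≟ b) (τ %ℕ n ℕ.≟ 0)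
    where
    τ = ℤ.+ diff (col p′) (col p)
    S = shift τ (pts (words C b))
    shifted = Δ-≡⇒shiftPoint eq
    twoCommon : 2 ≤ ∣ pts (words C a) ∩ S ∣
    twoCommon = ∈-∈-≢⇒2≤length (∈-∩⁺ p∈ (subst (_∈ S) (proj₁ shifted) (∈-shift⁺ τ p′∈)))
                             (∈-∩⁺ q∈ (subst (_∈ S) (proj₂ shifted) (∈-shift⁺ τ q′∈))) p≢q
    conclude : Dec (a ≡ b) → Dec (τ %ℕ n ≡ 0) → a ≡ b × p ≡ p′ × q ≡ q′
    conclude (no a≢b)   _         = ⊥-elim (<⇒≱ twoCommon (cross C a b a≢b τ))
    conclude (yes refl) (no τ≢0)  = ⊥-elim (<⇒≱ twoCommon (auto C a τ τ≢0))
    conclude (yes refl) (yes τ≡0) = refl , unshift p′ (proj₁ shifted) , unshift q′ (proj₂ shifted)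
      where
      unshift : ∀ {x} y → shiftPoint τ y ≡ x → x ≡ y
      unshift y eq′ = trans (sym eq′) (shiftPoint-by-0 τ y τ≡0)

  ∣∩shift∣≤1 : ∀ {k s} (w : Fin s → Codeword m n k) → PairDifferencesDistinct w →
               ∀ a b τ → a ≢ b ⊎ τ %ℕ n ≢ 0 → ∣ pts (w a) ∩ shift τ (pts (w b)) ∣ ≤ 1
  ∣∩shift∣≤1 w Δ-distinct a b τ a≢b⊎τ≢0 with ∣ pts (w a) ∩ shift τ (pts (w b)) ∣ ℕ.≤? 1
  ... | yes ≤1 = ≤1
  ... | no ≰1 = ⊥-elim (impossible (≰⇒> ≰1))
    where
    S = shift τ (pts (w b))
    impossible : 2 ≤ ∣ pts (w a) ∩ S ∣ → ⊥
    impossible two with 2≤length⇒∈-∈-≢ (Unique.filter⁺ (_∈? S) (Codeword.distinct (w a))) two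
    ... | x , y , x∈ , y∈ , x≢y with ∈-filter⁻ (_∈? S) x∈ | ∈-filter⁻ (_∈? S) y∈
    ... | x∈A , x∈S | y∈A , y∈S with ∈-shift⁻ τ x∈S | ∈-shift⁻ τ y∈S
    ... | x′ , x′∈B , refl | y′ , y′∈B , refl
      with Δ-distinct {a} {b} x∈A y∈A x≢y x′∈B y′∈B (x≢y ∘ cong (shiftPoint τ)) (Δ-shiftPoint τ x′ y′)
    ... | refl , x≡x′ , _ = [ (λ a≢a → a≢a refl) , (λ τ≢0 → τ≢0 (shiftPoint-fixed τ x′ x≡x′)) ]′ a≢b⊎τ≢0

  pairDifferencesDistinct⇒OOC : ∀ {k s} (w : Fin s → Codeword m n k) → PairDifferencesDistinct w → OOC m n k
  pairDifferencesDistinct⇒OOC {s = s} w Δ-distinct = record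
    { size  = s
    ; words = w
    ; auto  = λ a τ τ≢0 → ∣∩shift∣≤1 w Δ-distinct a a τ (inj₂ τ≢0)
    ; cross = λ a b a≢b τ → ∣∩shift∣≤1 w Δ-distinct a b τ (inj₁ a≢b)
    }

-- Parity and the upper bound

Odd : ℕ → Set
Odd x = x % 2 ≡ 1

odd? : Decidable Odd
odd? x = x % 2 ℕ.≟ 1

¬odd⇒%2≡0 : ∀ x → ¬ Odd x → x % 2 ≡ 0
¬odd⇒%2≡0 x ¬odd with x % 2 | m%n<n x 2
... | 0           | _                = refl
... | 1           | _                = ⊥-elim (¬odd refl)
... | suc (suc _) | s≤s (s≤s ())

length-filter-odd : ∀ {B : Set} (f : B → ℕ) xs → length (filter (odd? ∘ f) xs) ≡ sum (map (λ x → f x % 2) xs)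
length-filter-odd f []       = refl
length-filter-odd f (x ∷ xs) with odd? (f x)
... | yes odd rewrite filter-accept (odd? ∘ f) {xs = xs} odd | odd = cong suc (length-filter-odd f xs)
... | no ¬odd rewrite filter-reject (odd? ∘ f) {xs = xs} ¬odd | ¬odd⇒%2≡0 (f x) ¬odd = length-filter-odd f xs

length-filter-odd-downFrom : ∀ k → length (filter odd? (downFrom (k * 2))) ≡ k
length-filter-odd-downFrom zero    = refl
length-filter-odd-downFrom (suc k) =
  trans (cong length (filter-accept odd? {x = suc (k * 2)} {xs = k * 2 ∷ downFrom (k * 2)} ([m+kn]%n≡m%n 1 k 2)))
        (cong suc (trans (cong length (filter-reject odd? {x = k * 2} {xs = downFrom (k * 2)} k*2-even))
                         (length-filter-odd-downFrom k)))
  where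
  k*2-even : ¬ Odd (k * 2)
  k*2-even odd = 0≢1+n (trans (sym (m*n%n≡0 k 2)) odd)

length-filter-even-downFrom : ∀ k → length (filter (∁? odd?) (downFrom (k * 2))) ≡ k
length-filter-even-downFrom k = +-cancelˡ-≡ k evens k (begin
  k + evens                                         ≡⟨ cong (_+ evens) (length-filter-odd-downFrom k) ⟨
  length (filter odd? (downFrom (k * 2))) + evens   ≡⟨ length-filter-∁ odd? (downFrom (k * 2)) ⟩
  length (downFrom (k * 2))                         ≡⟨ length-downFrom (k * 2) ⟩
  k * 2                                             ≡⟨ m*2≡m+m k ⟩
  k + k                                             ∎)
  where
  open ≡-Reasoning
  evens = length (filter (∁? odd?) (downFrom (k * 2)))

%2-distrib : ∀ a b → (a + b) % 2 ≡ (a % 2 + b % 2) % 2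
%2-distrib a b = %-distribˡ-+ a b 2

-- Among three numbers an even number of the three pairwise sums is odd.
4∣pairSumParities : ∀ x y z →
  4 ∣ (x + y) % 2 + ((y + x) % 2 + ((x + z) % 2 + ((z + x) % 2 + ((y + z) % 2 + ((z + y) % 2 + 0)))))
4∣pairSumParities x y z
  rewrite %2-distrib x y | %2-distrib y x | %2-distrib x z | %2-distrib z x | %2-distrib y z | %2-distrib z y
  = bits (m%n<n x 2) (m%n<n y 2) (m%n<n z 2)
  where
  bits : ∀ {X Y Z} → X < 2 → Y < 2 → Z < 2 →
    4 ∣ (X + Y) % 2 + ((Y + X) % 2 + ((X + Z) % 2 + ((Z + X) % 2 + ((Y + Z) % 2 + ((Z + Y) % 2 + 0)))))
  bits (s≤s z≤n)       (s≤s z≤n)       (s≤s z≤n)       = divides 0 refl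
  bits (s≤s z≤n)       (s≤s z≤n)       (s≤s (s≤s z≤n)) = divides 1 refl
  bits (s≤s z≤n)       (s≤s (s≤s z≤n)) (s≤s z≤n)       = divides 1 refl
  bits (s≤s z≤n)       (s≤s (s≤s z≤n)) (s≤s (s≤s z≤n)) = divides 1 refl
  bits (s≤s (s≤s z≤n)) (s≤s z≤n)       (s≤s z≤n)       = divides 1 refl
  bits (s≤s (s≤s z≤n)) (s≤s z≤n)       (s≤s (s≤s z≤n)) = divides 1 refl
  bits (s≤s (s≤s z≤n)) (s≤s (s≤s z≤n)) (s≤s z≤n)       = divides 1 refl
  bits (s≤s (s≤s z≤n)) (s≤s (s≤s z≤n)) (s≤s (s≤s z≤n)) = divides 0 refl

module UpperBound (t : ℕ) .{{_ : NonZero (t * 2)}} where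

  n : ℕ
  n = t * 2

  open Residues {n}
  open PairDifferences {3} {n}

  0<t : 0 < t
  0<t = >-nonZero⁻¹ t {{m*n≢0⇒m≢0 t}}

  t<n : t < n
  t<n = subst (t <_) (sym (m*2≡m+m t)) (m<m+n t 0<t)

  Difference : Set
  Difference = Fin 3 × Fin 3 × ℕ

  offset : Difference → ℕ
  offset (_ , _ , δ) = δ

  offset<n : ∀ p q → offset (Δ p q) < n
  offset<n p q = diff<n (col p) (col q)

  diff-half : ∀ {x y} → x < n → y < n → diff x y ≡ t → diff y x ≡ t
  diff-half {x} {y} x<n y<n d≡t = begin
    diff y x            ≡⟨ diff-swap y<n x<n ⟨
    (n ∸ diff x y) % n  ≡⟨ cong (λ d → (n ∸ d) % n) d≡t ⟩
    (n ∸ t) % n         ≡⟨ cong (_% n) (m*2∸m≡m t) ⟩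
    t % n               ≡⟨ m<n⇒m%n≡m t<n ⟩
    t                   ∎
    where open ≡-Reasoning

  offset-parity : ∀ p q → offset (Δ p q) % 2 ≡ (col p + col q) % 2
  offset-parity p q = begin
    (y + (n ∸ x)) % n % 2          ≡⟨ m∣n⇒o%n%m≡o%m 2 n (y + (n ∸ x)) (divides t refl) ⟩
    (y + (n ∸ x)) % 2              ≡⟨ [m+kn]%n≡m%n (y + (n ∸ x)) x 2 ⟨
    (y + (n ∸ x) + x * 2) % 2      ≡⟨ cong (_% 2) (y+D+x*2≡y+x+[D+x] y (n ∸ x) x) ⟩
    (y + x + (n ∸ x + x)) % 2      ≡⟨ cong (λ z → (y + x + z) % 2) (m∸n+n≡m (<⇒≤ (col<n p))) ⟩
    (y + x + t * 2) % 2            ≡⟨ [m+kn]%n≡m%n (y + x) t 2 ⟩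
    (y + x) % 2                    ≡⟨ cong (_% 2) (+-comm y x) ⟩
    (x + y) % 2                    ∎
    where
    open ≡-Reasoning
    x = col p
    y = col q
    y+D+x*2≡y+x+[D+x] : ∀ y D x → y + D + x * 2 ≡ y + x + (D + x)
    y+D+x*2≡y+x+[D+x] = solve-∀

  forbidden : List Difference
  forbidden = cartesianProductWith (λ i δ → i , i , δ) (allFin 3) (0 ∷ t ∷ [])

  unique-forbidden : Unique forbidden
  unique-forbidden = Unique.cartesianProductWith⁺ (λ i δ → i , i , δ) diagonal-injective
    (Unique.allFin⁺ 3) ((0≢t ∷ []) ∷ [] ∷ [])
    where
    0≢t : 0 ≢ t
    0≢t = <⇒≢ 0<t
    diagonal-injective : ∀ {i j δ ε} → (Difference ∋ (i , i , δ)) ≡ (j , j , ε) → i ≡ j × δ ≡ ε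
    diagonal-injective refl = refl , refl

  -- A difference in the same row is never 0, and it is never n/2 because the reversed pair would share it.
  Δ∉forbidden : ∀ {k s} (w : Fin s → Codeword 3 n k) → PairDifferencesDistinct w →
    ∀ {a p q} → p ∈ pts (w a) → q ∈ pts (w a) → p ≢ q → Δ p q ∉ forbidden
  Δ∉forbidden w Δ-distinct {p = p} {q} p∈ q∈ p≢q Δ∈ with forbidden-shape Δ∈
    where
    forbidden-shape : ∀ {d} → d ∈ forbidden → ∃[ i ] (d ≡ (i , i , 0) ⊎ d ≡ (i , i , t))
    forbidden-shape (here d≡)                                         = _ , inj₁ d≡
    forbidden-shape (there (here d≡))                                 = _ , inj₂ d≡
    forbidden-shape (there (there (here d≡)))                         = _ , inj₁ d≡
    forbidden-shape (there (there (there (here d≡))))                 = _ , inj₂ d≡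
    forbidden-shape (there (there (there (there (here d≡)))))         = _ , inj₁ d≡
    forbidden-shape (there (there (there (there (there (here d≡)))))) = _ , inj₂ d≡
  ... | i , inj₁ Δ≡ = p≢q (point-≡ (trans (cong proj₁ Δ≡) (sym (cong (proj₁ ∘ proj₂) Δ≡)))
                                   (diff≡0⇒≡ (col<n p) (col<n q) (cong (proj₂ ∘ proj₂) Δ≡)))
  ... | i , inj₂ Δ≡ = p≢q (proj₁ (proj₂ (Δ-distinct p∈ q∈ p≢q q∈ p∈ (≢-sym p≢q) (trans Δ≡ (sym Δqp≡)))))
    where
    Δqp≡ : Δ q p ≡ (i , i , t)
    Δqp≡ = cong₂ _,_ (cong (proj₁ ∘ proj₂) Δ≡)
             (cong₂ _,_ (cong proj₁ Δ≡) (diff-half (col<n p) (col<n q) (cong (proj₂ ∘ proj₂) Δ≡)))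

  pairDifferences : Triple (Point 3 n) → List Difference
  pairDifferences T = map (uncurry Δ) (orderedPairs T)

  oddCount evenCount : List Difference → ℕ
  oddCount  = length ∘ filter (odd? ∘ offset)
  evenCount = length ∘ filter (∁? (odd? ∘ offset))

  4∣oddCount-pairDifferences : ∀ T → 4 ∣ oddCount (pairDifferences T)
  4∣oddCount-pairDifferences (a , b , c) = subst (4 ∣_) (sym oddCount≡) (4∣pairSumParities (col a) (col b) (col c))
    where
    oddCount≡ = trans (length-filter-odd offset (pairDifferences (a , b , c)))
      (cong₂ _+_ (offset-parity a b) (cong₂ _+_ (offset-parity b a) (cong₂ _+_ (offset-parity a c)
        (cong₂ _+_ (offset-parity c a) (cong₂ _+_ (offset-parity b c) (cong₂ _+_ (offset-parity c b) refl))))))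

  4∣oddCount-concatMap : ∀ {B : Set} (f : B → List Difference) → (∀ b → 4 ∣ oddCount (f b)) →
                         ∀ bs → 4 ∣ oddCount (concatMap f bs)
  4∣oddCount-concatMap f 4∣f []       = divides 0 refl
  4∣oddCount-concatMap f 4∣f (b ∷ bs) =
    subst (4 ∣_) (sym (trans (cong length (filter-++ (odd? ∘ offset) (f b) _))
                             (length-++ (filter (odd? ∘ offset) (f b)))))
          (∣m∣n⇒∣m+n (4∣f b) (4∣oddCount-concatMap f 4∣f bs))

  differencesIn : ∀ {P : ℕ → Set} → Decidable P → Fin 3 → Fin 3 → List Difference
  differencesIn P? i j = map (λ δ → i , j , δ) (filter P? (downFrom n))

  differencesWith : ∀ {P : ℕ → Set} → Decidable P → List Difference
  differencesWith P? = concatMap (λ i → concatMap (differencesIn P? i) (allFin 3)) (allFin 3)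

  length-differencesWith : ∀ {P : ℕ → Set} (P? : Decidable P) →
                           length (differencesWith P?) ≡ 3 * (3 * length (filter P? (downFrom n)))
  length-differencesWith P? =
    length-concatMap (λ i → concatMap (differencesIn P? i) (allFin 3))
      (λ i → length-concatMap (differencesIn P? i) (λ _ → length-map _ (filter P? (downFrom n))) (allFin 3)) (allFin 3)

  ∈-differencesWith : ∀ {P : ℕ → Set} (P? : Decidable P) {d} → offset d < n → P (offset d) →
                      d ∈ differencesWith P?
  ∈-differencesWith P? {i , j , δ} δ<n Pδ =
    ∈-concatMap⁺ (λ i → concatMap (differencesIn P? i) (allFin 3)) (Any.map (λ { refl →
      ∈-concatMap⁺ (differencesIn P? i) (Any.map (λ { refl → ∈-map⁺ _ (∈-filter⁺ P? (∈-downFrom⁺ δ<n) Pδ) })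
                                                (∈-allFin j)) })
      (∈-allFin i))

  length-filter-offset≤ : ∀ {P : ℕ → Set} (P? : Decidable P) {ds} → Unique ds → All (λ d → offset d < n) ds →
                   length (filter (P? ∘ offset) ds) ≤ length (differencesWith P?)
  length-filter-offset≤ P? !ds bounded = unique-⊆⇒length≤ (Unique.filter⁺ (P? ∘ offset) !ds) λ d∈ →
    let d∈ds , Pd = ∈-filter⁻ (P? ∘ offset) d∈ in ∈-differencesWith P? (All.lookup bounded d∈ds) Pd

  module _ (C : OOC 3 n 3) where

    private
      s = OOC.size C
      w = words C
      Δ-distinct = OOC⇒pairDifferencesDistinct C

    corners : Fin s → Triple (Point 3 n)
    corners a = toTriple (pts (w a)) (Codeword.size (w a))

    vertices-corners : ∀ a → vertices (corners a) ≡ pts (w a)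
    vertices-corners a = vertices-toTriple (pts (w a)) (Codeword.size (w a))

    unique-corners : ∀ a → Unique (vertices (corners a))
    unique-corners a = subst Unique (sym (vertices-corners a)) (Codeword.distinct (w a))

    chordsOf : Fin s → List (Fin s × Point 3 n × Point 3 n)
    chordsOf a = map (a ,_) (orderedPairs (corners a))

    chords : List (Fin s × Point 3 n × Point 3 n)
    chords = concatMap chordsOf (allFin s)

    ∈-chords⁻ : ∀ {a p q} → (a , p , q) ∈ chords → p ∈ pts (w a) × q ∈ pts (w a) × p ≢ q
    ∈-chords⁻ {a} x∈ with satisfied (∈-concatMap⁻ chordsOf {xs = allFin s} x∈)
    ... | b , x∈b with ∈-map⁻ (b ,_) x∈b
    ... | _ , p,q∈ , refl with ∈-orderedPairs⁻ (corners a) (unique-corners a) p,q∈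
    ... | p∈ , q∈ , p≢q = subst (_ ∈_) (vertices-corners a) p∈ , subst (_ ∈_) (vertices-corners a) q∈ , p≢q

    unique-chords : Unique chords
    unique-chords = Unique.concat⁺
      (Allₚ.map⁺ (All.universal (λ a → Unique.map⁺ ,-injectiveʳ (unique-orderedPairs (corners a) (unique-corners a)))
                                (allFin s)))
      (AllPairsₚ.map⁺ (AllPairs.map disjoint (Unique.allFin⁺ s)))
      where
      disjoint : ∀ {a b} → a ≢ b → Disjoint (chordsOf a) (chordsOf b)
      disjoint {a} {b} a≢b (x∈a , x∈b) with ∈-map⁻ (a ,_) x∈a | ∈-map⁻ (b ,_) x∈b
      ... | _ , _ , refl | _ , _ , x≡ = a≢b (cong proj₁ x≡)

    chordΔ : Fin s × Point 3 n × Point 3 n → Difference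
    chordΔ (_ , p , q) = Δ p q

    differences : List Difference
    differences = map chordΔ chords

    unique-differences : Unique differences
    unique-differences = unique-map⁺ chordΔ-injective unique-chords
      where
      chordΔ-injective : ∀ {x y} → x ∈ chords → y ∈ chords → chordΔ x ≡ chordΔ y → x ≡ y
      chordΔ-injective {a , p , q} {b , p′ , q′} x∈ y∈ eq with ∈-chords⁻ x∈ | ∈-chords⁻ y∈
      ... | p∈ , q∈ , p≢q | p′∈ , q′∈ , p′≢q′ with Δ-distinct p∈ q∈ p≢q p′∈ q′∈ p′≢q′ eq
      ... | refl , refl , refl = refl

    length-differences : length differences ≡ s * 6
    length-differences = trans (length-map chordΔ chords)
      (trans (length-concatMap _ (λ a → length-map (a ,_) (orderedPairs (corners a))) (allFin s))
             (cong (_* 6) (length-tabulate {n = s} id)))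

    4∣oddCount-differences : 4 ∣ oddCount differences
    4∣oddCount-differences = subst (λ ds → 4 ∣ oddCount ds) (sym (map-concatMap chordΔ _ (allFin s)))
      (4∣oddCount-concatMap _ (λ a → 4∣oddCount-pairDifferences (corners a)) (allFin s))

    private
      oD = oddCount differences
      eD = evenCount differences
      oF = oddCount forbidden
      eF = evenCount forbidden

    unique-differences++forbidden : Unique (differences ++ forbidden)
    unique-differences++forbidden = Unique.++⁺ unique-differences unique-forbidden λ (d∈D , d∈F) →
      let x , x∈ , d≡ = ∈-map⁻ chordΔ d∈D
          p∈ , q∈ , p≢q = ∈-chords⁻ x∈
      in Δ∉forbidden w Δ-distinct p∈ q∈ p≢q (subst (_∈ forbidden) d≡ d∈F)

    bounded : All (λ d → offset d < n) (differences ++ forbidden)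
    bounded = Allₚ.++⁺ (Allₚ.map⁺ (All.universal (λ (_ , p , q) → offset<n p q) chords))
                                (0<n ∷ t<n ∷ 0<n ∷ t<n ∷ 0<n ∷ t<n ∷ [])
      where 0<n = >-nonZero⁻¹ n

    differences+forbidden≤ : ∀ {P : ℕ → Set} (P? : Decidable P) →
      length (filter (P? ∘ offset) differences) + length (filter (P? ∘ offset) forbidden)
        ≤ 3 * (3 * length (filter P? (downFrom n)))
    differences+forbidden≤ P? = begin
      length (filter (P? ∘ offset) differences) + length (filter (P? ∘ offset) forbidden)
        ≡⟨ length-++ (filter (P? ∘ offset) differences) ⟨
      length (filter (P? ∘ offset) differences ++ filter (P? ∘ offset) forbidden)
        ≡⟨ cong length (filter-++ (P? ∘ offset) differences forbidden) ⟨
      length (filter (P? ∘ offset) (differences ++ forbidden))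
        ≤⟨ length-filter-offset≤ P? unique-differences++forbidden bounded ⟩
      length (differencesWith P?)
        ≡⟨ length-differencesWith P? ⟩
      3 * (3 * length (filter P? (downFrom n))) ∎
      where open ≤-Reasoning

    oddCount≤ : oD + oF ≤ 3 * (3 * t)
    oddCount≤ = subst (λ k → oD + oF ≤ 3 * (3 * k)) (length-filter-odd-downFrom t) (differences+forbidden≤ odd?)

    evenCount≤ : eD + eF ≤ 3 * (3 * t)
    evenCount≤ = subst (λ k → eD + eF ≤ 3 * (3 * k)) (length-filter-even-downFrom t) (differences+forbidden≤ (∁? odd?))

    size*6+6+slack≤t*18 : ∀ x → oD + oF + x ≤ 3 * (3 * t) → s * 6 + (6 + x) ≤ t * 18
    size*6+6+slack≤t*18 x oD+oF+x≤ = begin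
      s * 6 + (6 + x)              ≡⟨ cong₂ (λ a b → a + (b + x)) (trans (length-filter-∁ _ differences) length-differences)
                                                                  (length-filter-∁ (odd? ∘ offset) forbidden) ⟨
      oD + eD + (oF + eF + x)      ≡⟨ rearrange oD eD oF eF x ⟩
      oD + oF + x + (eD + eF)      ≤⟨ +-mono-≤ oD+oF+x≤ evenCount≤ ⟩
      3 * (3 * t) + 3 * (3 * t)    ≡⟨ 9t+9t≡18t t ⟩
      t * 18                       ∎
      where
      open ≤-Reasoning
      rearrange : ∀ a b c d x → a + b + (c + d + x) ≡ a + c + x + (b + d)
      rearrange = solve-∀
      9t+9t≡18t : ∀ t → 3 * (3 * t) + 3 * (3 * t) ≡ t * 18
      9t+9t≡18t = solve-∀

    size*6+6≤t*18 : s * 6 + 6 ≤ t * 18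
    size*6+6≤t*18 = size*6+6+slack≤t*18 0 (subst (_≤ 3 * (3 * t)) (sym (+-identityʳ (oD + oF))) oddCount≤)

    oddCount-forbidden : oF ≡ t % 2 + (t % 2 + (t % 2 + 0))
    oddCount-forbidden = length-filter-odd offset forbidden

    -- 9t − oF ≡ 2 (mod 4) here, so the multiple of 4 that is oD stays 2 below the bound.
    oddCount+2≤ : ∀ u → t ≡ 1 + u * 4 ⊎ t ≡ 2 + u * 4 → oD + oF + 2 ≤ 3 * (3 * t)
    oddCount+2≤ u (inj₁ refl) = subst₂ (λ f b → oD + f + 2 ≤ b) (sym oF≡3) (sym (9t≡ u))
      (4∣m⇒m+c+2≤4q+2+c 3 (1 + u * 9) 4∣oddCount-differences (subst₂ (λ f b → oD + f ≤ b) oF≡3 (9t≡ u) oddCount≤))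
      where
      oF≡3 : oF ≡ 3
      oF≡3 = trans oddCount-forbidden (cong (λ p → p + (p + (p + 0))) ([1+u*4]%2≡1 u))
      9t≡ : ∀ u → 3 * (3 * (1 + u * 4)) ≡ (1 + u * 9) * 4 + 2 + 3
      9t≡ = solve-∀
    oddCount+2≤ u (inj₂ refl) = subst₂ (λ f b → oD + f + 2 ≤ b) (sym oF≡0) (sym (9t≡ u))
      (4∣m⇒m+c+2≤4q+2+c 0 (4 + u * 9) 4∣oddCount-differences (subst₂ (λ f b → oD + f ≤ b) oF≡0 (9t≡ u) oddCount≤))
      where
      oF≡0 : oF ≡ 0
      oF≡0 = trans oddCount-forbidden (cong (λ p → p + (p + (p + 0))) ([2+u*4]%2≡0 u))
      9t≡ : ∀ u → 3 * (3 * (2 + u * 4)) ≡ (4 + u * 9) * 4 + 2 + 0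
      9t≡ = solve-∀

    size*6+8≤t*18 : ∀ u → t ≡ 1 + u * 4 ⊎ t ≡ 2 + u * 4 → s * 6 + 8 ≤ t * 18
    size*6+8≤t*18 u t≡ = size*6+6+slack≤t*18 2 (oddCount+2≤ u t≡)

-- Codes assembled from patterns

data Label : Set where
  from₀ from₁ central : ℕ → Label
  none : Label

-- The base words of row i are {(i,0), (i,gap k), (i+1,across₀ k)} for k < t ∸ 1; across₁ k is the
-- difference seen from the middle vertex, and gapIndex and label invert the differences used.
record Pattern (t : ℕ) : Set where
  field
    gap across₀ across₁ gapIndex : ℕ → ℕ
    label : ℕ → Label
    hole : ℕ
    0<gap         : ∀ {k} → k < t ∸ 1 → 0 < gap k
    gap<t         : ∀ {k} → k < t ∸ 1 → gap k < t
    gapIndex-gap  : ∀ {k} → k < t ∸ 1 → gapIndex (gap k) ≡ k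
    across₀<n     : ∀ {k} → k < t ∸ 1 → across₀ k < t * 2
    across₁<n     : ∀ {k} → k < t ∸ 1 → across₁ k < t * 2
    across₁+gap   : ∀ {k} → k < t ∸ 1 → across₁ k + gap k ≡ across₀ k ⊎ across₁ k + gap k ≡ across₀ k + t * 2
    label-across₀ : ∀ {k} → k < t ∸ 1 → label (across₀ k) ≡ from₀ k
    label-across₁ : ∀ {k} → k < t ∸ 1 → label (across₁ k) ≡ from₁ k
    label-0       : label 0 ≡ central 0
    label-hole    : label hole ≡ central 1
    hole<n        : hole < t * 2

next : Fin 3 → Fin 3
next 0F = 1F
next 1F = 2F
next 2F = 0F

module Assembly (t : ℕ) .{{_ : NonZero (t * 2)}} (P : Fin 3 → Pattern t) where

  n K : ℕ
  n = t * 2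
  K = t ∸ 1

  open Residues {n}
  open PairDifferences {3} {n}
  open Pattern

  0<n : 0 < n
  0<n = >-nonZero⁻¹ n

  gap<n : ∀ i {k} → k < K → gap (P i) k < n
  gap<n i k<K = <-≤-trans (gap<t (P i) k<K) (m≤m*n t 2)

  point : Fin 3 → ℕ → Point 3 n
  point i x = i , x mod n

  baseWord : Fin 3 → ℕ → Triple (Point 3 n)
  baseWord i k = point i 0 , point i (gap (P i) k) , point (next i) (across₀ (P i) k)

  centralWord : ℕ × ℕ → Triple (Point 3 n)
  centralWord (x , y) = point 0F 0 , point 1F x , point 2F y

  Decoded : Set
  Decoded = ℕ × Fin 3 × Fin 3

  swap : Decoded → Decoded
  swap (j , u , v) = j , v , u

  diagonal : Fin 3 → ℕ → Decoded
  diagonal i δ with δ ℕ.<? t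
  ... | yes _ = K * toℕ i + gapIndex (P i) δ , 0F , 1F
  ... | no _  = K * toℕ i + gapIndex (P i) (n ∸ δ) , 1F , 0F

  fromLabel : Fin 3 → Label → Decoded
  fromLabel i (from₀ k)   = K * toℕ i + k , 0F , 2F
  fromLabel i (from₁ k)   = K * toℕ i + k , 1F , 2F
  fromLabel i (central c) = 3 * K + c , i , next i
  fromLabel i none        = 0 , 0F , 0F

  forward backward : Fin 3 → ℕ → Decoded
  forward i δ  = fromLabel i (label (P i) δ)
  backward i δ = swap (forward i ((n ∸ δ) % n))

  decode : Fin 3 × Fin 3 × ℕ → Decoded
  decode (0F , 0F , δ) = diagonal 0F δ
  decode (0F , 1F , δ) = forward 0F δ
  decode (0F , 2F , δ) = backward 2F δ
  decode (1F , 0F , δ) = backward 0F δ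
  decode (1F , 1F , δ) = diagonal 1F δ
  decode (1F , 2F , δ) = forward 1F δ
  decode (2F , 0F , δ) = forward 2F δ
  decode (2F , 1F , δ) = backward 1F δ
  decode (2F , 2F , δ) = diagonal 2F δ

  Decodes : ℕ → Triple (Point 3 n) → Set
  Decodes j T = ∀ u v → u ≢ v → decode (Δ (T ! u) (T ! v)) ≡ (j , u , v)

  Δ-point : ∀ i j {x y} → x < n → y < n → Δ (point i x) (point j y) ≡ (i , j , diff x y)
  Δ-point i j x<n y<n = cong (λ d → i , j , d)
    (cong₂ diff (trans (Fin.toℕ-fromℕ< _) (m<n⇒m%n≡m x<n)) (trans (Fin.toℕ-fromℕ< _) (m<n⇒m%n≡m y<n)))

  decodes-cross : ∀ i {x y j u v} → x < n → y < n → forward i (diff x y) ≡ (j , u , v) →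
                  decode (Δ (point i x) (point (next i) y)) ≡ (j , u , v) ×
                  decode (Δ (point (next i) y) (point i x)) ≡ (j , v , u)
  decodes-cross i {x} {y} x<n y<n fwd =
    trans (cong decode (Δ-point i (next i) x<n y<n)) (trans (decode-forward i) fwd) ,
    trans (cong decode (Δ-point (next i) i y<n x<n))
          (trans (decode-backward i) (cong swap (trans (cong (forward i) (diff-swap x<n y<n)) fwd)))
    where
    decode-forward : ∀ i {δ} → decode (i , next i , δ) ≡ forward i δ
    decode-forward 0F = refl
    decode-forward 1F = refl
    decode-forward 2F = refl
    decode-backward : ∀ i {δ} → decode (next i , i , δ) ≡ backward i δ
    decode-backward 0F = refl
    decode-backward 1F = refl
    decode-backward 2F = refl

  diagonal-below : ∀ i {δ} → δ < t → diagonal i δ ≡ (K * toℕ i + gapIndex (P i) δ , 0F , 1F)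
  diagonal-below i {δ} δ<t with δ ℕ.<? t
  ... | yes _   = refl
  ... | no δ≮t = contradiction δ<t δ≮t

  diagonal-above : ∀ i {δ} → t ≤ δ → diagonal i δ ≡ (K * toℕ i + gapIndex (P i) (n ∸ δ) , 1F , 0F)
  diagonal-above i {δ} t≤δ with δ ℕ.<? t
  ... | yes δ<t = contradiction t≤δ (<⇒≱ δ<t)
  ... | no _    = refl

  decode-diagonal : ∀ i {δ} → decode (i , i , δ) ≡ diagonal i δ
  decode-diagonal 0F = refl
  decode-diagonal 1F = refl
  decode-diagonal 2F = refl

  across₁≡diff : ∀ i {k} → k < K → across₁ (P i) k ≡ diff (gap (P i) k) (across₀ (P i) k)
  across₁≡diff i {k} k<K =
    sym (diff-unique (<⇒≤ (gap<n i k<K)) (across₁<n (P i) k<K) (wrap {across₁ (P i) k} (across₁+gap (P i) k<K)))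
    where
    wrap : ∀ {a g r} → a + g ≡ r ⊎ a + g ≡ r + n → (g + a) % n ≡ r % n
    wrap {a} {g} (inj₁ a+g≡r)       = cong (_% n) (trans (+-comm g a) a+g≡r)
    wrap {a} {g} {r} (inj₂ a+g≡r+n) = trans (cong (_% n) (trans (+-comm g a) a+g≡r+n)) ([m+n]%n≡m%n r n)

  decodes-within : ∀ i {k} → k < K → let g = gap (P i) k in
                   decode (Δ (point i 0) (point i g)) ≡ (K * toℕ i + k , 0F , 1F) ×
                   decode (Δ (point i g) (point i 0)) ≡ (K * toℕ i + k , 1F , 0F)
  decodes-within i {k} k<K =
    trans (cong decode (Δ-point i i 0<n (gap<n i k<K)))
      (trans (cong (λ d → decode (i , i , d)) (diff-from-0 (gap<n i k<K)))
        (trans (decode-diagonal i) (trans (diagonal-below i (gap<t (P i) k<K))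
               (cong (λ j → K * toℕ i + j , 0F , 1F) gapIndex≡)))) ,
    trans (cong decode (Δ-point i i (gap<n i k<K) 0<n))
      (trans (cong (λ d → decode (i , i , d)) (diff-to-0 (0<gap (P i) k<K) (<⇒≤ (gap<n i k<K))))
        (trans (decode-diagonal i) (trans (diagonal-above i t≤n∸g)
          (trans (cong (λ j → K * toℕ i + gapIndex (P i) j , 1F , 0F) (m∸[m∸n]≡n (<⇒≤ (gap<n i k<K))))
                 (cong (λ j → K * toℕ i + j , 1F , 0F) gapIndex≡)))))
    where
    gapIndex≡ = gapIndex-gap (P i) k<K
    t≤n∸g : t ≤ n ∸ gap (P i) k
    t≤n∸g = subst (_≤ n ∸ gap (P i) k) (m*2∸m≡m t) (∸-monoʳ-≤ n (<⇒≤ (gap<t (P i) k<K)))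

  base-decodes : ∀ i {k} → k < K → Decodes (K * toℕ i + k) (baseWord i k)
  base-decodes i {k} k<K = decodes
    where
    r<n = across₀<n (P i) k<K
    within = decodes-within i k<K
    cross₀ = decodes-cross i 0<n r<n
      (cong (fromLabel i) (trans (cong (label (P i)) (diff-from-0 r<n)) (label-across₀ (P i) k<K)))
    cross₁ = decodes-cross i (gap<n i k<K) r<n
      (cong (fromLabel i) (trans (cong (label (P i)) (sym (across₁≡diff i k<K))) (label-across₁ (P i) k<K)))
    decodes : Decodes (K * toℕ i + k) (baseWord i k)
    decodes 0F 1F _   = proj₁ within
    decodes 1F 0F _   = proj₂ within
    decodes 0F 2F _   = proj₁ cross₀
    decodes 2F 0F _   = proj₂ cross₀
    decodes 1F 2F _   = proj₁ cross₁
    decodes 2F 1F _   = proj₂ cross₁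
    decodes 0F 0F u≢u = contradiction refl u≢u
    decodes 1F 1F u≢u = contradiction refl u≢u
    decodes 2F 2F u≢u = contradiction refl u≢u

  CentralLabels : ℕ → ℕ × ℕ → Set
  CentralLabels c (x , y) = x < n × y < n × label (P 0F) x ≡ central c ×
                            label (P 1F) (diff x y) ≡ central c × label (P 2F) (diff y 0) ≡ central c

  central-decodes : ∀ c xy → CentralLabels c xy → Decodes (3 * K + c) (centralWord xy)
  central-decodes c (x , y) (x<n , y<n , ℓ₀ , ℓ₁ , ℓ₂) = decodes
    where
    c₀ = decodes-cross 0F 0<n x<n (cong (fromLabel 0F) (trans (cong (label (P 0F)) (diff-from-0 x<n)) ℓ₀))
    c₁ = decodes-cross 1F x<n y<n (cong (fromLabel 1F) ℓ₁)
    c₂ = decodes-cross 2F y<n 0<n (cong (fromLabel 2F) ℓ₂)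
    decodes : Decodes (3 * K + c) (centralWord (x , y))
    decodes 0F 1F _ = proj₁ c₀
    decodes 1F 0F _ = proj₂ c₀
    decodes 1F 2F _ = proj₁ c₁
    decodes 2F 1F _ = proj₂ c₁
    decodes 2F 0F _ = proj₁ c₂
    decodes 0F 2F _ = proj₂ c₂
    decodes 0F 0F u≢u = contradiction refl u≢u
    decodes 1F 1F u≢u = contradiction refl u≢u
    decodes 2F 2F u≢u = contradiction refl u≢u

  decodes⇒unique : ∀ {j} T → Decodes j T → Unique (vertices T)
  decodes⇒unique T decodes =
    (collide {0F} {1F} {2F} (λ ()) (λ ()) (λ ()) ∷ collide {0F} {2F} {1F} (λ ()) (λ ()) (λ ()) ∷ [])
    ∷ (collide {1F} {2F} {0F} (λ ()) (λ ()) (λ ()) ∷ []) ∷ [] ∷ []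
    where
    collide : ∀ {u v w} → u ≢ v → u ≢ w → v ≢ w → T ! u ≢ T ! v
    collide {u} {v} {w} u≢v u≢w v≢w eq = u≢v (cong (proj₁ ∘ proj₂)
      (trans (sym (decodes u w u≢w)) (trans (cong (λ p → decode (Δ p (T ! w))) eq) (decodes v w v≢w))))

  module _ (nc : ℕ) (centres : Fin nc → ℕ × ℕ) (centres-ok : ∀ c → CentralLabels (toℕ c) (centres c)) where

    baseWordAt : Fin (3 * K) → Triple (Point 3 n)
    baseWordAt b = baseWord (proj₁ (remQuot {3} K b)) (toℕ (proj₂ (remQuot {3} K b)))

    word : Fin (3 * K + nc) → Triple (Point 3 n)
    word j with splitAt (3 * K) j
    ... | inj₁ b = baseWordAt b
    ... | inj₂ c = centralWord (centres c)

    word-decodes : ∀ j → Decodes (toℕ j) (word j)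
    word-decodes j with splitAt (3 * K) j in split≡
    ... | inj₁ b = subst (λ m → Decodes m (baseWordAt b)) index≡ (base-decodes i (Fin.toℕ<n k))
      where
      i = proj₁ (remQuot {3} K b)
      k = proj₂ (remQuot {3} K b)
      index≡ : K * toℕ i + toℕ k ≡ toℕ j
      index≡ = trans (sym (Fin.toℕ-combine i k)) (trans (cong toℕ (Fin.combine-remQuot {3} K b))
                     (trans (sym (Fin.toℕ-↑ˡ b nc)) (cong toℕ (Fin.splitAt⁻¹-↑ˡ split≡))))
    ... | inj₂ c = subst (λ m → Decodes m (centralWord (centres c))) index≡
                         (central-decodes (toℕ c) (centres c) (centres-ok c))
      where
      index≡ : 3 * K + toℕ c ≡ toℕ j
      index≡ = trans (sym (Fin.toℕ-↑ʳ (3 * K) c)) (cong toℕ (Fin.splitAt⁻¹-↑ʳ split≡))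

    codewordAt : Fin (3 * K + nc) → Codeword 3 n 3
    codewordAt j = codeword (vertices (word j)) (decodes⇒unique (word j) (word-decodes j)) refl

    distinct-differences : PairDifferencesDistinct codewordAt
    distinct-differences {a} {b} p∈ q∈ p≢q p′∈ q′∈ p′≢q′ Δ≡
      with ∈-vertices⁻ (word a) p∈ | ∈-vertices⁻ (word a) q∈ | ∈-vertices⁻ (word b) p′∈ | ∈-vertices⁻ (word b) q′∈
    ... | u , refl | v , refl | u′ , refl | v′ , refl
      with decoded ← trans (sym (word-decodes a u v (λ u≡v → p≢q (cong (word a !_) u≡v))))
                           (trans (cong decode Δ≡) (word-decodes b u′ v′ (λ u′≡v′ → p′≢q′ (cong (word b !_) u′≡v′))))
      with Fin.toℕ-injective (cong proj₁ decoded) | cong (proj₁ ∘ proj₂) decoded | cong (proj₂ ∘ proj₂) decoded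
    ... | refl | refl | refl = refl , refl , refl

    assembled : OOC 3 n 3
    assembled = pairDifferencesDistinct⇒OOC codewordAt distinct-differences

  centre₀-labels : CentralLabels 0 (0 , 0)
  centre₀-labels = 0<n , 0<n , label-0 (P 0F) ,
    trans (cong (label (P 1F)) (diff-from-0 0<n)) (label-0 (P 1F)) ,
    trans (cong (label (P 2F)) (diff-from-0 0<n)) (label-0 (P 2F))

  centre₁-labels : hole (P 0F) + hole (P 1F) + hole (P 2F) ≡ n →
                   CentralLabels 1 (hole (P 0F) , hole (P 0F) + hole (P 1F))
  centre₁-labels holes≡n = hole<n (P 0F) , h₀+h₁<n , label-hole (P 0F) ,
    trans (cong (label (P 1F)) (diff-unique (<⇒≤ (hole<n (P 0F))) (hole<n (P 1F)) refl)) (label-hole (P 1F)) ,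
    trans (cong (label (P 2F)) (diff-unique (<⇒≤ h₀+h₁<n) (hole<n (P 2F)) wraps)) (label-hole (P 2F))
    where
    h₀ = hole (P 0F)
    h₁ = hole (P 1F)
    h₂ = hole (P 2F)
    0<h₂ : 0 < h₂
    0<h₂ = ≤∧≢⇒< z≤n λ 0≡h₂ → central0≢central1
      (trans (sym (label-0 (P 2F))) (trans (cong (label (P 2F)) 0≡h₂) (label-hole (P 2F))))
      where
      central0≢central1 : central 0 ≢ central 1
      central0≢central1 ()
    h₀+h₁<n : h₀ + h₁ < n
    h₀+h₁<n = subst (h₀ + h₁ <_) holes≡n (m<m+n (h₀ + h₁) 0<h₂)
    wraps : (h₀ + h₁ + h₂) % n ≡ 0 % n
    wraps = trans (cong (_% n) holes≡n) (trans (n%n≡0 n) (sym (m<n⇒m%n≡m 0<n)))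

  oneCentral : OOC 3 n 3
  oneCentral = assembled 1 (λ _ → 0 , 0) λ { 0F → centre₀-labels }

  twoCentral : hole (P 0F) + hole (P 1F) + hole (P 2F) ≡ n → OOC 3 n 3
  twoCentral holes≡n = assembled 2 centres λ { 0F → centre₀-labels ; 1F → centre₁-labels holes≡n }
    where
    centres : Fin 2 → ℕ × ℕ
    centres 0F = 0 , 0
    centres 1F = hole (P 0F) , hole (P 0F) + hole (P 1F)

-- Patterns from run-length specifications

-- The run lengths of the patterns are affine in the parameter u of t = r + 4u; representing them
-- symbolically makes every well-formedness condition of a specification a closed computation.
record Affine : Set where
  constructor affine
  field
    const slope : ℕ

open Affine

infixl 6 _⊕_
infix  9 #_ _·u
infix  4 _≤ᴬ_

#_ : ℕ → Affine
# c = affine c 0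

_·u : ℕ → Affine
k ·u = affine 0 k

_⊕_ : Affine → Affine → Affine
a ⊕ b = affine (const a + const b) (slope a + slope b)

⟦_⟧ : Affine → ℕ → ℕ
⟦ a ⟧ u = const a + u * slope a

-- Sufficient, not necessary, for ⟦ a ⟧ u ≤ ⟦ b ⟧ u at every u.
_≤ᴬ_ : Affine → Affine → Set
a ≤ᴬ b = T (const a ℕ.≤ᵇ const b) × T (slope a ℕ.≤ᵇ slope b)

⟦⊕⟧ : ∀ a b u → ⟦ a ⊕ b ⟧ u ≡ ⟦ a ⟧ u + ⟦ b ⟧ u
⟦⊕⟧ (affine c k) (affine c′ k′) u = distrib c k c′ k′ u
  where
  distrib : ∀ c k c′ k′ u → c + c′ + u * (k + k′) ≡ c + u * k + (c′ + u * k′)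
  distrib = solve-∀

⟦#⟧ : ∀ c u → ⟦ # c ⟧ u ≡ c
⟦#⟧ c u = trans (cong (c +_) (*-zeroʳ u)) (+-identityʳ c)

⟦⟧-mono : ∀ {a b} u → a ≤ᴬ b → ⟦ a ⟧ u ≤ ⟦ b ⟧ u
⟦⟧-mono {a} {b} u (c≤c′ , k≤k′) =
  +-mono-≤ (≤ᵇ⇒≤ (const a) (const b) c≤c′) (*-monoʳ-≤ u (≤ᵇ⇒≤ (slope a) (slope b) k≤k′))

module _ {S : Set} (lengthᴬ : S → Affine) where

  totalᴬ : List S → Affine
  totalᴬ = foldr (λ s → lengthᴬ s ⊕_) (# 0)

  startᴬ : List S → ℕ → Affine
  startᴬ ss i = totalᴬ (take i ss)

module Segments {S A : Set} (lengthᴬ : S → Affine) (u : ℕ) (at : S → ℕ → A) (default : A) where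

  len : S → ℕ
  len s = ⟦ lengthᴬ s ⟧ u

  total : List S → ℕ
  total ss = sum (map len ss)

  start : List S → ℕ → ℕ
  start ss i = total (take i ss)

  decode : List S → ℕ → A
  decode []       _ = default
  decode (s ∷ ss) x with x ℕ.<? len s
  ... | yes _ = at s x
  ... | no _  = decode ss (x ∸ len s)

  decode-start : ∀ ss i {s o} → head (drop i ss) ≡ just s → o < len s → decode ss (start ss i + o) ≡ at s o
  decode-start (s ∷ ss) zero {o = o} refl o<len with o ℕ.<? len s
  ... | yes _     = refl
  ... | no o≮len = contradiction o<len o≮len
  decode-start (s′ ∷ ss) (suc i) {o = o} eq o<len with len s′ + start ss i + o ℕ.<? len s′
  ... | yes lt = contradiction lt (≤⇒≯ (≤-trans (m≤m+n (len s′) _) (m≤m+n _ o)))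
  ... | no _   = trans (cong (decode ss) (trans (cong (_∸ len s′) (+-assoc (len s′) _ o)) (m+n∸m≡n (len s′) _)))
                       (decode-start ss i eq o<len)

  start+o<total : ∀ ss i {s o} → head (drop i ss) ≡ just s → o < len s → start ss i + o < total ss
  start+o<total (s ∷ ss) zero    refl o<len = ≤-trans o<len (m≤m+n (len s) (total ss))
  start+o<total (s ∷ ss) (suc i) eq   o<len =
    subst (_< len s + total ss) (sym (+-assoc (len s) _ _)) (+-monoʳ-< (len s) (start+o<total ss i eq o<len))

  total≡⟦totalᴬ⟧ : ∀ ss → total ss ≡ ⟦ totalᴬ lengthᴬ ss ⟧ u
  total≡⟦totalᴬ⟧ []       = sym (⟦#⟧ 0 u)
  total≡⟦totalᴬ⟧ (s ∷ ss) = trans (cong (len s +_) (total≡⟦totalᴬ⟧ ss)) (sym (⟦⊕⟧ (lengthᴬ s) _ u))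

  start≡⟦startᴬ⟧ : ∀ ss i → start ss i ≡ ⟦ startᴬ lengthᴬ ss i ⟧ u
  start≡⟦startᴬ⟧ ss i = total≡⟦totalᴬ⟧ (take i ss)

data ValueSegment : Set where
  hole          : ℕ → ValueSegment
  from₀s from₁s : Affine → Affine → ValueSegment

valueLengthᴬ : ValueSegment → Affine
valueLengthᴬ (hole _)      = # 1
valueLengthᴬ (from₀s _ ℓ) = ℓ
valueLengthᴬ (from₁s _ ℓ) = ℓ

record GapRun : Set where
  constructor run
  field
    firstIndex runLength : Affine

data Gaps : Set where
  evens : Gaps
  odds  : ℕ → Gaps

record Family : Set where
  constructor family
  field
    size      : Affine
    gaps      : Gaps
    from₀At from₁At : ℕ

-- A run-length description of a pattern for t = ⟦ target ⟧ u.  The value segments tile 0, 1, ..., 2t − 1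
-- in order.  A family of size ℓ whose indices start at K has members K + j for j < ℓ: their across₀ values
-- run up through the from₀s segment at from₀At, their across₁ values run down through the from₁s segment
-- at from₁At, and their gaps are 2, 4, ... (evens) or consecutive odd numbers from a gap run, the gap runs
-- tiling 1, 3, 5, ... in order.
record Spec : Set where
  field
    target   : Affine
    gapRuns  : List GapRun
    values   : List ValueSegment
    families : List Family
    holeAt   : ℕ

module _ (S : Spec) where

  open Spec S

  firstGapᴬ : Gaps → Affine
  firstGapᴬ evens    = # 2
  firstGapᴬ (odds r) = # 1 ⊕ startᴬ GapRun.runLength gapRuns r ⊕ startᴬ GapRun.runLength gapRuns r

  GapsOK : Affine → Affine → Gaps → Set
  GapsOK K ℓ evens    = K ≡ # 0 × # 1 ⊕ ℓ ⊕ ℓ ≤ᴬ target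
  GapsOK K ℓ (odds r) = head (drop r gapRuns) ≡ just (run K ℓ)

  -- across₁ + gap ≡ across₀ (mod 2t) for the member j = 0, with 1 added on both sides to avoid ℓ ∸ 1.  It then
  -- holds for every member, since along a family across₁ falls by 1, the gap rises by 2 and across₀ rises by 1.
  Anchored : Affine → Gaps → ℕ → ℕ → Set
  Anchored ℓ g i₀ i₁ = St i₁ ⊕ ℓ ⊕ firstGapᴬ g ≡ # 1 ⊕ St i₀ ⊎
                       St i₁ ⊕ ℓ ⊕ firstGapᴬ g ≡ # 1 ⊕ St i₀ ⊕ target ⊕ target
    where St = startᴬ valueLengthᴬ values

  FamilyOK : Affine → Family → Set
  FamilyOK K (family ℓ g i₀ i₁) = head (drop i₀ values) ≡ just (from₀s K ℓ) × head (drop i₁ values) ≡ just (from₁s K ℓ) ×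
                                  GapsOK K ℓ g × Anchored ℓ g i₀ i₁

  FamiliesOK : Affine → List Family → Set
  FamiliesOK K []       = ⊤
  FamiliesOK K (F ∷ Fs) = FamilyOK K F × FamiliesOK (K ⊕ Family.size F) Fs

  record WellFormed : Set where
    field
      values-total   : totalᴬ valueLengthᴬ values ≡ target ⊕ target
      gaps-total     : totalᴬ GapRun.runLength gapRuns ⊕ totalᴬ GapRun.runLength gapRuns ≤ᴬ target
      families-total : # 1 ⊕ totalᴬ Family.size families ≡ target
      value-0        : head values ≡ just (hole 0)
      value-hole     : head (drop holeAt values) ≡ just (hole 1)
      families-ok    : FamiliesOK (# 0) families

module FromSpec (S : Spec) (wf : WellFormed S) (u : ℕ) where

  open Spec S
  open WellFormed wf

  t n : ℕ
  t = ⟦ target ⟧ u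
  n = t * 2

  valueLabel : ValueSegment → ℕ → Label
  valueLabel (hole c)     _ = central c
  valueLabel (from₀s K ℓ) o = from₀ (⟦ K ⟧ u + o)
  valueLabel (from₁s K ℓ) o = from₁ (⟦ K ⟧ u + (⟦ ℓ ⟧ u ∸ suc o))

  runIndex : GapRun → ℕ → ℕ
  runIndex (run K _) o = ⟦ K ⟧ u + o

  module V = Segments valueLengthᴬ u valueLabel none
  module R = Segments GapRun.runLength u runIndex 0

  gapOf : Gaps → ℕ → ℕ
  gapOf evens    j = (1 + j) * 2
  gapOf (odds r) j = 1 + (R.start gapRuns r + j) * 2

  member : Family → ℕ → ℕ × ℕ × ℕ
  member (family ℓ g i₀ i₁) j = gapOf g j , V.start values i₀ + j , V.start values i₁ + (⟦ ℓ ⟧ u ∸ suc j)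

  module M = Segments Family.size u member (0 , 0 , 0)

  gapIndex : ℕ → ℕ
  gapIndex δ with δ % 2 ℕ.≟ 0
  ... | yes _ = δ / 2 ∸ 1
  ... | no _  = R.decode gapRuns (δ / 2)

  label : ℕ → Label
  label = V.decode values

  gapIndex-even : ∀ j → gapIndex ((1 + j) * 2) ≡ j
  gapIndex-even j with ((1 + j) * 2) % 2 ℕ.≟ 0
  ... | yes _    = cong (_∸ 1) (m*n/n≡m (1 + j) 2)
  ... | no odd = contradiction (m*n%n≡0 (1 + j) 2) odd

  gapIndex-odd : ∀ h → gapIndex (1 + h * 2) ≡ R.decode gapRuns h
  gapIndex-odd h with (1 + h * 2) % 2 ℕ.≟ 0
  ... | yes even = contradiction (trans (sym ([m+kn]%n≡m%n 1 h 2)) even) λ ()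
  ... | no _     = cong (R.decode gapRuns) ([1+m*2]/2≡m h)

  values-total≡n : V.total values ≡ n
  values-total≡n = begin
    V.total values                      ≡⟨ V.total≡⟦totalᴬ⟧ values ⟩
    ⟦ totalᴬ valueLengthᴬ values ⟧ u    ≡⟨ cong (λ a → ⟦ a ⟧ u) values-total ⟩
    ⟦ target ⊕ target ⟧ u               ≡⟨ ⟦⊕⟧ target target u ⟩
    t + t                               ≡⟨ m*2≡m+m t ⟨
    t * 2                               ∎
    where open ≡-Reasoning

  value<n : ∀ i {s o} → head (drop i values) ≡ just s → o < ⟦ valueLengthᴬ s ⟧ u → V.start values i + o < n
  value<n i {o = o} at o< = subst (V.start values i + o <_) values-total≡n (V.start+o<total values i at o<)

  record Good (k g a₀ a₁ : ℕ) : Set where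
    field
      0<g      : 0 < g
      g<t      : g < t
      index-g  : gapIndex g ≡ k
      a₀<n     : a₀ < n
      a₁<n     : a₁ < n
      a₁+g     : a₁ + g ≡ a₀ ⊎ a₁ + g ≡ a₀ + n
      label-a₀ : label a₀ ≡ from₀ k
      label-a₁ : label a₁ ≡ from₁ k

  GoodMember : ℕ → ℕ × ℕ × ℕ → Set
  GoodMember k (g , a₀ , a₁) = Good k g a₀ a₁

  anchored : ∀ {S₀ S₁ g₀ j L} → j < L → S₁ + L + g₀ ≡ 1 + S₀ ⊎ S₁ + L + g₀ ≡ 1 + S₀ + t + t →
             S₁ + (L ∸ suc j) + (g₀ + j * 2) ≡ S₀ + j ⊎ S₁ + (L ∸ suc j) + (g₀ + j * 2) ≡ S₀ + j + n
  anchored {S₀} {S₁} {g₀} {j} {L} j<L anchor with L ∸ suc j | m+[n∸m]≡n j<L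
  ... | e | refl = Sum.map (λ eq → suc-injective (trans (shift₁ S₁ j e g₀) (cong (_+ j) eq)))
                           (λ eq → suc-injective (trans (shift₁ S₁ j e g₀) (trans (cong (_+ j) eq) (shift₂ S₀ t j))))
                           anchor
    where
    shift₁ : ∀ S₁ j e g₀ → suc (S₁ + e + (g₀ + j * 2)) ≡ S₁ + suc (j + e) + g₀ + j
    shift₁ = solve-∀
    shift₂ : ∀ S₀ t j → 1 + S₀ + t + t + j ≡ suc (S₀ + j + t * 2)
    shift₂ = solve-∀

  V-start≡ : ∀ i → V.start values i ≡ ⟦ startᴬ valueLengthᴬ values i ⟧ u
  V-start≡ = V.start≡⟦startᴬ⟧ values

  R-start≡ : ∀ r → R.start gapRuns r ≡ ⟦ startᴬ GapRun.runLength gapRuns r ⟧ u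
  R-start≡ = R.start≡⟦startᴬ⟧ gapRuns

  firstGap : Gaps → ℕ
  firstGap evens    = 2
  firstGap (odds r) = 1 + R.start gapRuns r + R.start gapRuns r

  ⟦firstGapᴬ⟧ : ∀ g → ⟦ firstGapᴬ S g ⟧ u ≡ firstGap g
  ⟦firstGapᴬ⟧ evens    = ⟦#⟧ 2 u
  ⟦firstGapᴬ⟧ (odds r) = trans (⟦⊕⟧ (# 1 ⊕ G) G u)
    (cong₂ _+_ (trans (⟦⊕⟧ (# 1) G u) (cong₂ _+_ (⟦#⟧ 1 u) (sym (R-start≡ r)))) (sym (R-start≡ r)))
    where G = startᴬ GapRun.runLength gapRuns r

  gapOf≡ : ∀ g j → gapOf g j ≡ firstGap g + j * 2
  gapOf≡ evens    j = refl
  gapOf≡ (odds r) j = expand (R.start gapRuns r) j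
    where
    expand : ∀ h j → 1 + (h + j) * 2 ≡ 1 + h + h + j * 2
    expand = solve-∀

  0<gapOf : ∀ g j → 0 < gapOf g j
  0<gapOf evens    _ = s≤s z≤n
  0<gapOf (odds _) _ = s≤s z≤n

  gapOf<t : ∀ {K ℓ} g → GapsOK S K ℓ g → ∀ {j} → j < ⟦ ℓ ⟧ u → gapOf g j < t
  gapOf<t {ℓ = ℓ} evens (_ , evens≤) {j} j<L = begin-strict
    (1 + j) * 2           ≤⟨ *-monoˡ-≤ 2 j<L ⟩
    L * 2                 ≡⟨ m*2≡m+m L ⟩
    L + L                 <⟨ n<1+n (L + L) ⟩
    1 + L + L             ≡⟨ cong (λ c → c + L + L) (⟦#⟧ 1 u) ⟨
    ⟦ # 1 ⟧ u + L + L     ≡⟨ trans (⟦⊕⟧ (# 1 ⊕ ℓ) ℓ u) (cong (_+ L) (⟦⊕⟧ (# 1) ℓ u)) ⟨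
    ⟦ # 1 ⊕ ℓ ⊕ ℓ ⟧ u     ≤⟨ ⟦⟧-mono u evens≤ ⟩
    t                     ∎
    where
    open ≤-Reasoning
    L = ⟦ ℓ ⟧ u
  gapOf<t (odds r) at-run {j} j<L = begin-strict
    1 + h * 2             <⟨ n<1+n (1 + h * 2) ⟩
    suc h * 2             ≤⟨ *-monoˡ-≤ 2 (R.start+o<total gapRuns r at-run j<L) ⟩
    Rt * 2                ≡⟨ m*2≡m+m Rt ⟩
    Rt + Rt               ≡⟨ cong₂ _+_ (R.total≡⟦totalᴬ⟧ gapRuns) (R.total≡⟦totalᴬ⟧ gapRuns) ⟩
    ⟦ Rtᴬ ⟧ u + ⟦ Rtᴬ ⟧ u ≡⟨ ⟦⊕⟧ Rtᴬ Rtᴬ u ⟨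
    ⟦ Rtᴬ ⊕ Rtᴬ ⟧ u       ≤⟨ ⟦⟧-mono u gaps-total ⟩
    t                     ∎
    where
    open ≤-Reasoning
    h = R.start gapRuns r + j
    Rt = R.total gapRuns
    Rtᴬ = totalᴬ GapRun.runLength gapRuns

  gapIndex-gapOf : ∀ {K ℓ} g → GapsOK S K ℓ g → ∀ {j} → j < ⟦ ℓ ⟧ u → gapIndex (gapOf g j) ≡ ⟦ K ⟧ u + j
  gapIndex-gapOf evens (K≡0 , _) {j} _ =
    trans (gapIndex-even j) (cong (_+ j) (sym (trans (cong (λ K → ⟦ K ⟧ u) K≡0) (⟦#⟧ 0 u))))
  gapIndex-gapOf (odds r) at-run j<L = trans (gapIndex-odd _) (R.decode-start gapRuns r at-run j<L)

  ⟦Anchored⟧ : ∀ {ℓ} g i₀ i₁ → Anchored S ℓ g i₀ i₁ →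
               let L = ⟦ ℓ ⟧ u ; S₀ = V.start values i₀ ; S₁ = V.start values i₁ in
               S₁ + L + firstGap g ≡ 1 + S₀ ⊎ S₁ + L + firstGap g ≡ 1 + S₀ + t + t
  ⟦Anchored⟧ {ℓ} g i₀ i₁ = Sum.map (λ eq → trans (sym lhs≡) (trans (cong (λ a → ⟦ a ⟧ u) eq) rhs≡))
    (λ eq → trans (sym lhs≡) (trans (cong (λ a → ⟦ a ⟧ u) eq)
              (trans (⟦⊕⟧ (# 1 ⊕ St i₀ ⊕ target) target u)
                     (cong (_+ t) (trans (⟦⊕⟧ (# 1 ⊕ St i₀) target u) (cong (_+ t) rhs≡))))))
    where
    St = startᴬ valueLengthᴬ values
    lhs≡ : ⟦ St i₁ ⊕ ℓ ⊕ firstGapᴬ S g ⟧ u ≡ V.start values i₁ + ⟦ ℓ ⟧ u + firstGap g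
    lhs≡ = trans (⟦⊕⟧ (St i₁ ⊕ ℓ) (firstGapᴬ S g) u)
                 (cong₂ _+_ (trans (⟦⊕⟧ (St i₁) ℓ u) (cong (_+ ⟦ ℓ ⟧ u) (sym (V-start≡ i₁)))) (⟦firstGapᴬ⟧ g))
    rhs≡ : ⟦ # 1 ⊕ St i₀ ⟧ u ≡ 1 + V.start values i₀
    rhs≡ = trans (⟦⊕⟧ (# 1) (St i₀) u) (cong₂ _+_ (⟦#⟧ 1 u) (sym (V-start≡ i₀)))

  member-good : ∀ {K} F → FamilyOK S K F → ∀ {j} → j < ⟦ Family.size F ⟧ u → GoodMember (⟦ K ⟧ u + j) (member F j)
  member-good {K} (family ℓ g i₀ i₁) (at₀ , at₁ , gaps-ok , anchor) {j} j<L = record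
    { 0<g      = 0<gapOf g j
    ; g<t      = gapOf<t g gaps-ok j<L
    ; index-g  = gapIndex-gapOf g gaps-ok j<L
    ; a₀<n     = value<n i₀ at₀ j<L
    ; a₁<n     = value<n i₁ at₁ (reflect< j<L)
    ; a₁+g     = subst (λ γ → S₁ + (L ∸ suc j) + γ ≡ S₀ + j ⊎ S₁ + (L ∸ suc j) + γ ≡ S₀ + j + n)
                       (sym (gapOf≡ g j)) (anchored {S₀} {S₁} {firstGap g} j<L (⟦Anchored⟧ g i₀ i₁ anchor))
    ; label-a₀ = V.decode-start values i₀ at₀ j<L
    ; label-a₁ = trans (V.decode-start values i₁ at₁ (reflect< j<L))
                       (cong (λ x → from₁ (⟦ K ⟧ u + x)) (reflect-involutive j<L))
    }
    where
    L  = ⟦ ℓ ⟧ u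
    S₀ = V.start values i₀
    S₁ = V.start values i₁

  families-good : ∀ K Fs → FamiliesOK S K Fs → ∀ {k} → k < M.total Fs → GoodMember (⟦ K ⟧ u + k) (M.decode Fs k)
  families-good K (F ∷ Fs) (ok , oks) {k} k<total with k ℕ.<? ⟦ Family.size F ⟧ u
  ... | yes k<L = member-good F ok k<L
  ... | no k≮L  = subst (λ i → GoodMember i (M.decode Fs (k ∸ L))) index≡
                        (families-good (K ⊕ Family.size F) Fs oks k∸L<total)
    where
    L = ⟦ Family.size F ⟧ u
    L≤k = ≮⇒≥ k≮L
    k∸L<total : k ∸ L < M.total Fs
    k∸L<total = +-cancelˡ-< L _ _ (subst (_< L + M.total Fs) (sym (m+[n∸m]≡n L≤k)) k<total)
    index≡ : ⟦ K ⊕ Family.size F ⟧ u + (k ∸ L) ≡ ⟦ K ⟧ u + k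
    index≡ = trans (cong (_+ (k ∸ L)) (⟦⊕⟧ K (Family.size F) u))
                   (trans (+-assoc (⟦ K ⟧ u) L (k ∸ L)) (cong (⟦ K ⟧ u +_) (m+[n∸m]≡n L≤k)))

  good : ∀ {k} → k < t ∸ 1 → GoodMember k (M.decode families k)
  good {k} k<t∸1 = subst (λ i → GoodMember i (M.decode families k)) (cong (_+ k) (⟦#⟧ 0 u))
                         (families-good (# 0) families families-ok (subst (k <_) (sym total≡t∸1) k<t∸1))
    where
    total≡t∸1 : M.total families ≡ t ∸ 1
    total≡t∸1 = begin
      M.total families             ≡⟨ M.total≡⟦totalᴬ⟧ families ⟩
      ⟦ Fᴬ ⟧ u                     ≡⟨⟩
      1 + ⟦ Fᴬ ⟧ u ∸ 1             ≡⟨ cong (λ c → c + ⟦ Fᴬ ⟧ u ∸ 1) (⟦#⟧ 1 u) ⟨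
      ⟦ # 1 ⟧ u + ⟦ Fᴬ ⟧ u ∸ 1     ≡⟨ cong (_∸ 1) (⟦⊕⟧ (# 1) Fᴬ u) ⟨
      ⟦ # 1 ⊕ Fᴬ ⟧ u ∸ 1           ≡⟨ cong (λ a → ⟦ a ⟧ u ∸ 1) families-total ⟩
      t ∸ 1                        ∎
      where
      open ≡-Reasoning
      Fᴬ = totalᴬ Family.size families

  specPattern : Pattern t
  specPattern = record
    { gap           = λ k → proj₁ (M.decode families k)
    ; across₀       = λ k → proj₁ (proj₂ (M.decode families k))
    ; across₁       = λ k → proj₂ (proj₂ (M.decode families k))
    ; gapIndex      = gapIndex
    ; label         = label
    ; hole          = V.start values holeAt
    ; 0<gap         = λ k< → Good.0<g (good k<)
    ; gap<t         = λ k< → Good.g<t (good k<)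
    ; gapIndex-gap  = λ k< → Good.index-g (good k<)
    ; across₀<n     = λ k< → Good.a₀<n (good k<)
    ; across₁<n     = λ k< → Good.a₁<n (good k<)
    ; across₁+gap   = λ k< → Good.a₁+g (good k<)
    ; label-across₀ = λ k< → Good.label-a₀ (good k<)
    ; label-across₁ = λ k< → Good.label-a₁ (good k<)
    ; label-0       = V.decode-start values 0 value-0 (s≤s z≤n)
    ; label-hole    = subst (λ x → label x ≡ central 1) (+-identityʳ _)
                            (V.decode-start values holeAt value-hole (s≤s z≤n))
    ; hole<n        = subst (_< n) (+-identityʳ _) (value<n holeAt value-hole (s≤s z≤n))
    }

  hole≡ : Pattern.hole specPattern ≡ ⟦ startᴬ valueLengthᴬ values holeAt ⟧ u
  hole≡ = V-start≡ holeAt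

holeᴬ : Spec → Affine
holeᴬ S = startᴬ valueLengthᴬ (Spec.values S) (Spec.holeAt S)

holes≡n : ∀ (S₀ S₁ S₂ : Spec) (wf₀ : WellFormed S₀) (wf₁ : WellFormed S₁) (wf₂ : WellFormed S₂) u →
          holeᴬ S₀ ⊕ holeᴬ S₁ ⊕ holeᴬ S₂ ≡ Spec.target S₀ ⊕ Spec.target S₀ →
          Pattern.hole (FromSpec.specPattern S₀ wf₀ u) + Pattern.hole (FromSpec.specPattern S₁ wf₁ u)
            + Pattern.hole (FromSpec.specPattern S₂ wf₂ u) ≡ ⟦ Spec.target S₀ ⟧ u * 2
holes≡n S₀ S₁ S₂ wf₀ wf₁ wf₂ u sum≡ = begin
  h S₀ wf₀ + h S₁ wf₁ + h S₂ wf₂   ≡⟨ cong₂ _+_ (cong₂ _+_ (FromSpec.hole≡ S₀ wf₀ u) (FromSpec.hole≡ S₁ wf₁ u))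
                                                 (FromSpec.hole≡ S₂ wf₂ u) ⟩
  ⟦ a ⟧ u + ⟦ b ⟧ u + ⟦ c ⟧ u       ≡⟨ trans (⟦⊕⟧ (a ⊕ b) c u) (cong (_+ ⟦ c ⟧ u) (⟦⊕⟧ a b u)) ⟨
  ⟦ a ⊕ b ⊕ c ⟧ u                   ≡⟨ cong (λ x → ⟦ x ⟧ u) sum≡ ⟩
  ⟦ T₀ ⊕ T₀ ⟧ u                     ≡⟨ ⟦⊕⟧ T₀ T₀ u ⟩
  ⟦ T₀ ⟧ u + ⟦ T₀ ⟧ u               ≡⟨ m*2≡m+m (⟦ T₀ ⟧ u) ⟨
  ⟦ T₀ ⟧ u * 2                      ∎
  where
  open ≡-Reasoning
  h = λ S wf → Pattern.hole (FromSpec.specPattern S wf u)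
  a = holeᴬ S₀
  b = holeᴬ S₁
  c = holeᴬ S₂
  T₀ = Spec.target S₀

-- Gaps 2, 4, ..., 2E nested around the hole E + 1, and gaps 1, 3, ..., 2O − 1 nested around 2E + O + 3/2.
standard : Affine → Affine → Spec
standard E O = record
  { target   = # 1 ⊕ E ⊕ O
  ; gapRuns  = run E O ∷ []
  ; values   = hole 0 ∷ from₁s (# 0) E ∷ hole 1 ∷ from₀s (# 0) E ∷ from₁s E O ∷ from₀s E O ∷ []
  ; families = family E evens 3 1 ∷ family O (odds 0) 5 4 ∷ []
  ; holeAt   = 2
  }

standard-1+4u : WellFormed (standard (2 ·u) (2 ·u))
standard-1+4u = record
  { values-total = refl ; gaps-total = _ ; families-total = refl ; value-0 = refl ; value-hole = refl
  ; families-ok = (refl , refl , (refl , _) , inj₁ refl) , (refl , refl , refl , inj₁ refl) , _ }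

standard-2+4u : WellFormed (standard (2 ·u) (# 1 ⊕ 2 ·u))
standard-2+4u = record
  { values-total = refl ; gaps-total = _ ; families-total = refl ; value-0 = refl ; value-hole = refl
  ; families-ok = (refl , refl , (refl , _) , inj₁ refl) , (refl , refl , refl , inj₁ refl) , _ }

standard-3 : WellFormed (standard (# 1) (# 1))
standard-3 = record
  { values-total = refl ; gaps-total = _ ; families-total = refl ; value-0 = refl ; value-hole = refl
  ; families-ok = (refl , refl , (refl , _) , inj₁ refl) , (refl , refl , refl , inj₁ refl) , _ }

standard-4 : WellFormed (standard (# 1) (# 2))
standard-4 = record
  { values-total = refl ; gaps-total = _ ; families-total = refl ; value-0 = refl ; value-hole = refl
  ; families-ok = (refl , refl , (refl , _) , inj₁ refl) , (refl , refl , refl , inj₁ refl) , _ }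

standard-7+4u : WellFormed (standard (# 3 ⊕ 2 ·u) (# 3 ⊕ 2 ·u))
standard-7+4u = record
  { values-total = refl ; gaps-total = _ ; families-total = refl ; value-0 = refl ; value-hole = refl
  ; families-ok = (refl , refl , (refl , _) , inj₁ refl) , (refl , refl , refl , inj₁ refl) , _ }

standard-8+4u : WellFormed (standard (# 3 ⊕ 2 ·u) (# 4 ⊕ 2 ·u))
standard-8+4u = record
  { values-total = refl ; gaps-total = _ ; families-total = refl ; value-0 = refl ; value-hole = refl
  ; families-ok = (refl , refl , (refl , _) , inj₁ refl) , (refl , refl , refl , inj₁ refl) , _ }

-- A second central codeword needs holes adding up to 2t; two standard rows have holes E + 1, so the third
-- needs its hole at 2O, which the following patterns provide (t − 1, t and t for t = 7 + 4u, 8 + 4u and 4).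
hooked-7+4u : Spec
hooked-7+4u = record
  { target   = # 1 ⊕ a ⊕ a
  ; gapRuns  = run K₃ (# 1) ∷ run K₂ m₁ ∷ run K₄ (# 1) ∷ run a m ∷ []
  ; values   = hole 0 ∷ from₀s K₄ (# 1) ∷ from₀s K₂ m₁ ∷ from₀s a m ∷ from₁s (# 0) a ∷ hole 1 ∷ from₀s (# 0) a
             ∷ from₁s K₄ (# 1) ∷ from₁s a m ∷ from₁s K₃ (# 1) ∷ from₀s K₃ (# 1) ∷ from₁s K₂ m₁ ∷ []
  ; families = family a evens 6 4 ∷ family m (odds 3) 3 8 ∷ family m₁ (odds 1) 2 11
             ∷ family (# 1) (odds 0) 10 9 ∷ family (# 1) (odds 2) 1 7 ∷ []
  ; holeAt   = 5
  }
  where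
  m  = 1 ·u
  m₁ = # 1 ⊕ 1 ·u
  a  = # 3 ⊕ 2 ·u
  K₂ = a ⊕ m
  K₃ = K₂ ⊕ m₁
  K₄ = K₃ ⊕ # 1

hooked-7+4u-wf : WellFormed hooked-7+4u
hooked-7+4u-wf = record
  { values-total = refl ; gaps-total = _ ; families-total = refl ; value-0 = refl ; value-hole = refl
  ; families-ok = (refl , refl , (refl , _) , inj₁ refl) , (refl , refl , refl , inj₂ refl)
                , (refl , refl , refl , inj₂ refl) , (refl , refl , refl , inj₁ refl)
                , (refl , refl , refl , inj₂ refl) , _ }

hooked-8+4u : Spec
hooked-8+4u = record
  { target   = # 2 ⊕ a ⊕ a
  ; gapRuns  = run K₄ (# 1) ∷ run K₃ m ∷ run K₂ (# 1) ∷ run a b ∷ []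
  ; values   = hole 0 ∷ from₁s K₂ (# 1) ∷ from₀s K₃ m ∷ from₀s a b ∷ from₀s K₂ (# 1) ∷ from₁s (# 0) a ∷ hole 1
             ∷ from₀s (# 0) a ∷ from₁s a b ∷ from₁s K₄ (# 1) ∷ from₀s K₄ (# 1) ∷ from₁s K₃ m ∷ []
  ; families = family a evens 7 5 ∷ family b (odds 3) 3 8 ∷ family (# 1) (odds 2) 4 1
             ∷ family m (odds 1) 2 11 ∷ family (# 1) (odds 0) 10 9 ∷ []
  ; holeAt   = 6
  }
  where
  m  = 1 ·u
  a  = # 3 ⊕ 2 ·u
  b  = # 2 ⊕ 1 ·u
  K₂ = a ⊕ b
  K₃ = K₂ ⊕ # 1
  K₄ = K₃ ⊕ m

hooked-8+4u-wf : WellFormed hooked-8+4u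
hooked-8+4u-wf = record
  { values-total = refl ; gaps-total = _ ; families-total = refl ; value-0 = refl ; value-hole = refl
  ; families-ok = (refl , refl , (refl , _) , inj₁ refl) , (refl , refl , refl , inj₂ refl)
                , (refl , refl , refl , inj₁ refl) , (refl , refl , refl , inj₂ refl)
                , (refl , refl , refl , inj₁ refl) , _ }

hooked-4 : Spec
hooked-4 = record
  { target   = # 4
  ; gapRuns  = run (# 1) (# 1) ∷ run (# 2) (# 1) ∷ []
  ; values   = hole 0 ∷ from₁s (# 1) (# 1) ∷ from₀s (# 1) (# 1) ∷ from₁s (# 2) (# 1) ∷ hole 1
             ∷ from₁s (# 0) (# 1) ∷ from₀s (# 2) (# 1) ∷ from₀s (# 0) (# 1) ∷ []
  ; families = family (# 1) evens 7 5 ∷ family (# 1) (odds 0) 2 1 ∷ family (# 1) (odds 1) 6 3 ∷ []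
  ; holeAt   = 4
  }

hooked-4-wf : WellFormed hooked-4
hooked-4-wf = record
  { values-total = refl ; gaps-total = _ ; families-total = refl ; value-0 = refl ; value-hole = refl
  ; families-ok = (refl , refl , (refl , _) , inj₁ refl) , (refl , refl , refl , inj₁ refl)
                , (refl , refl , refl , inj₁ refl) , _ }

J-3×2t : ∀ t′ → J 3 (suc t′ * 2) ≡ 2 + t′ * 3
J-3×2t t′ = begin
  3 * ((3 * (suc t′ * 2) ∸ 1) / 2) / 3  ≡⟨ cong (λ x → 3 * ((x ∸ 1) / 2) / 3) (6t+6 t′) ⟩
  3 * ((1 + (2 + t′ * 3) * 2) / 2) / 3  ≡⟨ cong (λ x → 3 * x / 3) ([1+m*2]/2≡m (2 + t′ * 3)) ⟩
  3 * (2 + t′ * 3) / 3                  ≡⟨ cong (_/ 3) (*-comm 3 (2 + t′ * 3)) ⟩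
  (2 + t′ * 3) * 3 / 3                  ≡⟨ m*n/n≡m (2 + t′ * 3) 3 ⟩
  2 + t′ * 3                            ∎
  where
  open ≡-Reasoning
  6t+6 : ∀ t′ → 3 * (suc t′ * 2) ≡ 2 + (2 + t′ * 3) * 2
  6t+6 = solve-∀

J*-3×2t : ∀ r u → J* 3 ((suc r + u * 4) * 2) ≡
                  (if J*-exceptional 3 (suc r * 2) then 1 + (r + u * 4) * 3 else 2 + (r + u * 4) * 3)
J*-3×2t r u = begin
  J* 3 n                                                            ≡⟨⟩
  (if exceptional ((3 * n) % 24) then J 3 n ∸ 1 else J 3 n)         ≡⟨ cong₂ (λ x j → if exceptional x then j ∸ 1 else j)
                                                                             residue≡ (J-3×2t (r + u * 4)) ⟩
  (if exceptional ((3 * (suc r * 2)) % 24) then 1 + (r + u * 4) * 3 else 2 + (r + u * 4) * 3)  ∎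
  where
  open ≡-Reasoning
  n = (suc r + u * 4) * 2
  -- J*-exceptional 3 n, after the conditions that fail for m = 3 have been evaluated.
  exceptional : ℕ → Bool
  exceptional x = (x ℕ.≡ᵇ 14) ∨ (x ℕ.≡ᵇ 20) ∨ false ∨ false ∨ ((x ℕ.≡ᵇ 6) ∨ (x ℕ.≡ᵇ 12))
  residue≡ : (3 * n) % 24 ≡ (3 * (suc r * 2)) % 24
  residue≡ = trans (cong (_% 24) (expand r u)) ([m+kn]%n≡m%n (3 * (suc r * 2)) u 24)
    where
    expand : ∀ r u → 3 * ((suc r + u * 4) * 2) ≡ 3 * (suc r * 2) + u * 24
    expand = solve-∀

data Mod4 : ℕ → Set where
  1+4·_ : ∀ u → Mod4 (1 + u * 4)
  2+4·_ : ∀ u → Mod4 (2 + u * 4)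
  3+4·_ : ∀ u → Mod4 (3 + u * 4)
  4+4·_ : ∀ u → Mod4 (4 + u * 4)

mod4 : ∀ t → Mod4 (suc t)
mod4 0 = 1+4· 0
mod4 1 = 2+4· 0
mod4 2 = 3+4· 0
mod4 3 = 4+4· 0
mod4 (suc (suc (suc (suc t)))) with mod4 t
... | 1+4· u = 1+4· suc u
... | 2+4· u = 2+4· suc u
... | 3+4· u = 3+4· suc u
... | 4+4· u = 4+4· suc u

-- 3t − 2 for t ≡ 1, 2 and 3t − 1 for t ≡ 3, 0 (mod 4).
capacity : ∀ {t} → Mod4 t → ℕ
capacity (1+4· u) = 1 + u * 12
capacity (2+4· u) = 4 + u * 12
capacity (3+4· u) = 8 + u * 12
capacity (4+4· u) = 11 + u * 12

J*≡capacity : ∀ {t} (r : Mod4 t) → J* 3 (t * 2) ≡ capacity r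
J*≡capacity (1+4· u) = trans (J*-3×2t 0 u) (expand u)
  where
  expand : ∀ u → 1 + (0 + u * 4) * 3 ≡ 1 + u * 12
  expand = solve-∀
J*≡capacity (2+4· u) = trans (J*-3×2t 1 u) (expand u)
  where
  expand : ∀ u → 1 + (1 + u * 4) * 3 ≡ 4 + u * 12
  expand = solve-∀
J*≡capacity (3+4· u) = trans (J*-3×2t 2 u) (expand u)
  where
  expand : ∀ u → 2 + (2 + u * 4) * 3 ≡ 8 + u * 12
  expand = solve-∀
J*≡capacity (4+4· u) = trans (J*-3×2t 3 u) (expand u)
  where
  expand : ∀ u → 2 + (3 + u * 4) * 3 ≡ 11 + u * 12
  expand = solve-∀

codesAtMost : ∀ {t} (r : Mod4 t) .{{_ : NonZero (t * 2)}} (C : OOC 3 (t * 2) 3) → OOC.size C ≤ capacity r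
codesAtMost (1+4· u) C =
  ≤-from-*6 (1 + u * 12) 4 8 (s<s (s<s (s<s (s<s z<s))))
    (subst (OOC.size C * 6 + 8 ≤_) (18t u) (UpperBound.size*6+8≤t*18 (1 + u * 4) C u (inj₁ refl)))
  where
  18t : ∀ u → (1 + u * 4) * 18 ≡ (1 + u * 12) * 6 + 4 + 8
  18t = solve-∀
codesAtMost (2+4· u) C =
  ≤-from-*6 (4 + u * 12) 4 8 (s<s (s<s (s<s (s<s z<s))))
    (subst (OOC.size C * 6 + 8 ≤_) (18t u) (UpperBound.size*6+8≤t*18 (2 + u * 4) C u (inj₂ refl)))
  where
  18t : ∀ u → (2 + u * 4) * 18 ≡ (4 + u * 12) * 6 + 4 + 8
  18t = solve-∀
codesAtMost (3+4· u) C =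
  ≤-from-*6 (8 + u * 12) 0 6 z<s
    (subst (OOC.size C * 6 + 6 ≤_) (18t u) (UpperBound.size*6+6≤t*18 (3 + u * 4) C))
  where
  18t : ∀ u → (3 + u * 4) * 18 ≡ (8 + u * 12) * 6 + 0 + 6
  18t = solve-∀
codesAtMost (4+4· u) C =
  ≤-from-*6 (11 + u * 12) 0 6 z<s
    (subst (OOC.size C * 6 + 6 ≤_) (18t u) (UpperBound.size*6+6≤t*18 (4 + u * 4) C))
  where
  18t : ∀ u → (4 + u * 4) * 18 ≡ (11 + u * 12) * 6 + 0 + 6
  18t = solve-∀

lastRow : ∀ {t} → Pattern t → Pattern t → Fin 3 → Pattern t
lastRow P Q 2F = Q
lastRow P Q _  = P

codesAttained : ∀ {t} (r : Mod4 t) .{{_ : NonZero (t * 2)}} → Σ (OOC 3 (t * 2) 3) (λ C → OOC.size C ≡ capacity r)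
codesAttained (1+4· u) = Assembly.oneCentral (1 + u * 4) (λ _ → P) , size≡ u
  where
  P = FromSpec.specPattern (standard (2 ·u) (2 ·u)) standard-1+4u u
  size≡ : ∀ u → 3 * (u * 4) + 1 ≡ 1 + u * 12
  size≡ = solve-∀
codesAttained (2+4· u) = Assembly.oneCentral (2 + u * 4) (λ _ → P) , size≡ u
  where
  P = FromSpec.specPattern (standard (2 ·u) (# 1 ⊕ 2 ·u)) standard-2+4u u
  size≡ : ∀ u → 3 * (1 + u * 4) + 1 ≡ 4 + u * 12
  size≡ = solve-∀
codesAttained (3+4· zero) = Assembly.twoCentral 3 (λ _ → P) refl , refl
  where
  P = FromSpec.specPattern (standard (# 1) (# 1)) standard-3 0
codesAttained (3+4· suc u) =
  Assembly.twoCentral (7 + u * 4) (lastRow P Q) (holes≡n S S hooked-7+4u standard-7+4u standard-7+4u hooked-7+4u-wf u refl) ,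
  size≡ u
  where
  S = standard (# 3 ⊕ 2 ·u) (# 3 ⊕ 2 ·u)
  P = FromSpec.specPattern S standard-7+4u u
  Q = FromSpec.specPattern hooked-7+4u hooked-7+4u-wf u
  size≡ : ∀ u → 3 * (6 + u * 4) + 2 ≡ 8 + suc u * 12
  size≡ = solve-∀
codesAttained (4+4· zero) = Assembly.twoCentral 4 (lastRow P Q) refl , refl
  where
  P = FromSpec.specPattern (standard (# 1) (# 2)) standard-4 0
  Q = FromSpec.specPattern hooked-4 hooked-4-wf 0
codesAttained (4+4· suc u) =
  Assembly.twoCentral (8 + u * 4) (lastRow P Q) (holes≡n S S hooked-8+4u standard-8+4u standard-8+4u hooked-8+4u-wf u refl) ,
  size≡ u
  where
  S = standard (# 3 ⊕ 2 ·u) (# 4 ⊕ 2 ·u)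
  P = FromSpec.specPattern S standard-8+4u u
  Q = FromSpec.specPattern hooked-8+4u hooked-8+4u-wf u
  size≡ : ∀ u → 3 * (7 + u * 4) + 2 ≡ 11 + suc u * 12
  size≡ = solve-∀

lemma8p12 : ∀ (n : ℕ) .{{_ : NonZero n}} → 2 ∣ n →
    Σ (OOC 3 n 3) (λ C → Optimal C × OOC.size C ≡ J* 3 n)
lemma8p12 .(zero * 2) {{n≢0}} (divides zero refl) = ⊥-elim-irr (NonZero.nonZero n≢0)
lemma8p12 .(suc t * 2) (divides (suc t) refl) with codesAttained (mod4 t)
... | C , size≡capacity = C , optimal , trans size≡capacity (sym (J*≡capacity (mod4 t)))
  where
  optimal : Optimal C
  optimal D = subst (OOC.size D ≤_) (sym size≡capacity) (codesAtMost (mod4 t) D)
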